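{- For an integer $n \ge 1$, let $I_n = \mathbb{Z} \times n\mathbb{Z}$. Then $I_n$ is a maximal I-stable set if and only if either $n = 9$ or $n$ is a prime number other than $3$.
   Context: A lattice triangle is the convex hull in $\mathbb{R}^2$ of three non-collinear points of $\mathbb{Z}^2$. A triangle is a set $T = \Delta \cap \mathbb{Z}^2$ for a lattice triangle $\Delta$. An internal triangle is a triangle containing exactly $4$ points of $\mathbb{Z}^2$ whose non-vertex point lies in the interior of $\Delta$. A set $S \subseteq \mathbb{Z}^2$ is I-stable if no internal triangle has exactly three of its points in $S$. A maximal I-stable set is an I-stable proper subset $S \subsetneq \mathbb{Z}^2$ such that no I-stable proper subset of $\mathbb{Z}^2$ properly contains $S$. -}

module Defs where

open import Level using (Level; 0ℓ; suc)
open import Data.Nat using (ℕ)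
open import Data.Integer as ℤ using (ℤ; +_)
open import Data.Integer.Divisibility using (_∣_)
open import Data.Rational as ℚ using (ℚ; 0ℚ; 1ℚ)
open import Data.Product using (_×_; _,_; Σ; ∃; ∃-syntax; proj₁; proj₂)
open import Data.Sum using (_⊎_)
open import Relation.Binary.PropositionalEquality using (_≡_; _≢_)
open import Relation.Nullary using (¬_)
open import Relation.Unary using (Pred; _∈_; _∉_; _⊆_)

Point : Set
Point = ℤ × ℤ

Subset : Set₁
Subset = Pred Point 0ℓ

ι : ℤ → ℚ
ι z = z ℚ./ 1

det : Point → Point → Point → ℤ
det (px , py) (qx , qy) (rx , ry) =
  ((qx ℤ.- px) ℤ.* (ry ℤ.- py)) ℤ.- ((qy ℤ.- py) ℤ.* (rx ℤ.- px))

NonCollinear : Point → Point → Point → Set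
NonCollinear a b c = det a b c ≢ ℤ.0ℤ

IsCombination : Point → Point → Point → Point → ℚ → ℚ → ℚ → Set
IsCombination (ax , ay) (bx , by) (cx , cy) (x , y) l m n =
  (ι x ≡ (l ℚ.* ι ax) ℚ.+ (m ℚ.* ι bx) ℚ.+ (n ℚ.* ι cx)) ×
  (ι y ≡ (l ℚ.* ι ay) ℚ.+ (m ℚ.* ι by) ℚ.+ (n ℚ.* ι cy))

-- x lies in the lattice triangle conv{a,b,c} (convex combination).
-- (For integer points, rational weights suffice: the weights are
-- determined by Cramer's rule and hence rational.)
InHull : Point → Point → Point → Point → Set
InHull a b c x = ∃[ l ] ∃[ m ] ∃[ n ]
  (0ℚ ℚ.≤ l) × (0ℚ ℚ.≤ m) × (0ℚ ℚ.≤ n) × (l ℚ.+ m ℚ.+ n ≡ 1ℚ) ×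
  IsCombination a b c x l m n

InInterior : Point → Point → Point → Point → Set
InInterior a b c x = ∃[ l ] ∃[ m ] ∃[ n ]
  (0ℚ ℚ.< l) × (0ℚ ℚ.< m) × (0ℚ ℚ.< n) × (l ℚ.+ m ℚ.+ n ≡ 1ℚ) ×
  IsCombination a b c x l m n

-- The triangle T = conv{a,b,c} ∩ ℤ² is internal with non-vertex point d:
-- a,b,c non-collinear, d in the interior, and T = {a,b,c,d}.
-- (d ∉ {a,b,c} follows from d being interior.)
IsInternal : Point → Point → Point → Point → Set
IsInternal a b c d =
  NonCollinear a b c × InInterior a b c d ×
  (∀ x → InHull a b c x → (x ≡ a) ⊎ (x ≡ b) ⊎ (x ≡ c) ⊎ (x ≡ d))

ExactlyThreeIn : Subset → Point → Point → Point → Point → Set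
ExactlyThreeIn S a b c d =
  (a ∉ S × b ∈ S × c ∈ S × d ∈ S) ⊎
  (a ∈ S × b ∉ S × c ∈ S × d ∈ S) ⊎
  (a ∈ S × b ∈ S × c ∉ S × d ∈ S) ⊎
  (a ∈ S × b ∈ S × c ∈ S × d ∉ S)

IStable : Subset → Set
IStable S = ∀ a b c d → IsInternal a b c d → ¬ ExactlyThreeIn S a b c d

ProperSubset : Subset → Set
ProperSubset S = ∃[ p ] p ∉ S

StrictlyContained : Subset → Subset → Set
StrictlyContained S S' = (S ⊆ S') × (∃[ p ] (p ∈ S' × p ∉ S))

MaximalIStable : Subset → Set₁
MaximalIStable S =
  IStable S × ProperSubset S ×
  ¬ (Σ Subset λ S' → IStable S' × ProperSubset S' × StrictlyContained S S')

I : ℕ → Subset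
I n (x , y) = (+ n) ∣ y

-- An internal triangle with inner point d is, up to orientation, d + u, d + v, d - u - v with
-- det(u, v) = 1. Indeed, by Cramer's rule the barycentric coordinates of d are det d b c, det d c a and
-- det d a b over det a b c, and each of the triangles d a b, d b c, d c a has no lattice points besides its
-- vertices, so has determinant 1: otherwise Bézout's identity (or a lattice point on a non-primitive edge)
-- produces a fifth lattice point. Hence 3d = a + b + c and det(d, a, b) = ±1; reading second coordinates
-- modulo m shows that I m is I-stable if and only if m ≠ 3, with (0,0), (1,0), (-1,3), (0,1) breaking I 3.
-- A proper divisor m ≠ 3 of n gives the I-stable I m ⊋ I n, so maximality needs n = 9 or n prime ≠ 3.
-- Conversely, let S ⊋ I n be I-stable. A point of S in a row y coprime to n (for n = 9 perhaps after one
-- triangle to a row ±1) spreads along its row through triangles whose other vertices lie in rows of nℤ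
-- (for odd n by hopping to the row n - y and back, which shifts by two coprime amounts), and the triangle
-- rule on full rows then fills every row, so S would be all of ℤ².

module Submission where

open import Defs
open import Data.Nat as ℕ using (ℕ; zero; suc; z≤n; s≤s; _<_; _≤_)
import Data.Nat.Properties as ℕP
import Data.Nat.Divisibility as ℕD
open import Data.Nat.Divisibility.Core using (hasNonTrivialDivisor)
open import Data.Nat.GCD using (module Bézout; module GCD)
import Data.Nat.Coprimality as ℕCoprime
open import Data.Nat.Primality using (Prime; prime?; prime⇒nonTrivial; ¬prime⇒composite; prime⇒irreducible)
open import Data.Integer as ℤ
  using (ℤ; +_; -[1+_]; +[1+_]; _+_; _*_; _-_; -_; ∣_∣; 0ℤ; 1ℤ; -1ℤ; +≤+; +<+)
import Data.Integer.Properties as ℤP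
import Data.Integer.DivMod as ℤDM
open import Data.Integer.Divisibility.Signed
  using (_∣_; divides; ∣ᵤ⇒∣; ∣⇒∣ᵤ; ∣m⇒∣-m; ∣m∣n⇒∣m+n; ∣m∣n⇒∣m-n; ∣m+n∣m⇒∣n; ∣m+n∣n⇒∣m; ∣n⇒∣m*n; ∣m⇒∣m*n)
open import Data.Integer.Tactic.RingSolver using (solve-∀)
open import Data.Rational as ℚ using (ℚ; mkℚ; 0ℚ; 1ℚ; toℚᵘ; fromℚᵘ)
import Data.Rational.Properties as ℚP
open import Data.Rational.Unnormalised as ℚᵘ using (ℚᵘ; mkℚᵘ; _≃_; *≡*; *≤*; *<*; 0ℚᵘ; 1ℚᵘ)
  renaming (_+_ to _+ᵘ_; _*_ to _*ᵘ_; _-_ to _-ᵘ_; _≤_ to _≤ᵘ_; _<_ to _<ᵘ_)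
import Data.Rational.Unnormalised.Properties as ℚᵘP
import Tactic.RingSolver as RingSolver
import Tactic.RingSolver.Core.AlmostCommutativeRing as ACR
open import Data.Empty using (⊥; ⊥-elim)
open import Data.Product using (_×_; _,_; ∃; proj₁; proj₂; map; map₂) renaming (swap to ×-swap)
open import Data.Sum using (_⊎_; inj₁; inj₂)
open import Function.Bundles using (_⇔_; mk⇔)
open import Level using (0ℓ)
open import Relation.Binary.Definitions using (tri<; tri≈; tri>)
open import Relation.Binary.PropositionalEquality
open import Relation.Nullary using (¬_; yes; no)
open import Relation.Nullary.Decidable using (dec⇒maybe; from-yes)
open import Relation.Unary using (_∈_; _∉_; _⊆_)

-- Barycentric coordinates

-- Rational weights are handled in ℚᵘ, where the ring solver applies and signs can be read off numerators.
ℚᵘ-ring : ACR.AlmostCommutativeRing 0ℓ 0ℓ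
ℚᵘ-ring = ACR.fromCommutativeRing ℚᵘP.+-*-commutativeRing (λ x → dec⇒maybe (0ℚᵘ ℚᵘP.≃? x))

ιᵘ : ℤ → ℚᵘ
ιᵘ z = mkℚᵘ z 0

toℚᵘ-ι : ∀ z → toℚᵘ (ι z) ≡ ιᵘ z
toℚᵘ-ι z = cong toℚᵘ (ι≡mkℚ z)
  where
  coprime-1 : ∀ n → ℕCoprime.Coprime n 1
  coprime-1 n = ℕCoprime.sym (ℕCoprime.1-coprimeTo n)
  ι≡mkℚ : ∀ z → ι z ≡ mkℚ z 0 (coprime-1 ℤ.∣ z ∣)
  ι≡mkℚ (+ n) = ℚP.normalize-coprime (coprime-1 n)
  ι≡mkℚ -[1+ n ] = cong ℚ.-_ (ℚP.normalize-coprime (coprime-1 (suc n)))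

ιᵘ-+ : ∀ a b → ιᵘ (a + b) ≃ ιᵘ a +ᵘ ιᵘ b
ιᵘ-+ a b = *≡* (lemma a b)
  where
  lemma : ∀ a b → (a + b) * + 1 ≡ (a * + 1 + b * + 1) * + 1
  lemma = solve-∀

ιᵘ-- : ∀ a b → ιᵘ (a - b) ≃ ιᵘ a -ᵘ ιᵘ b
ιᵘ-- a b = ιᵘ-+ a (- b)

detᵘ : ℚᵘ → ℚᵘ → ℚᵘ → ℚᵘ → ℚᵘ → ℚᵘ → ℚᵘ
detᵘ p₁ p₂ q₁ q₂ r₁ r₂ = (q₁ -ᵘ p₁) *ᵘ (r₂ -ᵘ p₂) -ᵘ (q₂ -ᵘ p₂) *ᵘ (r₁ -ᵘ p₁)

-ᵘ-cong : ∀ {a b c d} → a ≃ b → c ≃ d → a -ᵘ c ≃ b -ᵘ d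
-ᵘ-cong p q = ℚᵘP.+-cong p (ℚᵘP.-‿cong q)

detᵘ-cong : ∀ {p₁ p₂ q₁ q₂ r₁ r₂ p₁′ p₂′ q₁′ q₂′ r₁′ r₂′} →
  p₁ ≃ p₁′ → p₂ ≃ p₂′ → q₁ ≃ q₁′ → q₂ ≃ q₂′ → r₁ ≃ r₁′ → r₂ ≃ r₂′ →
  detᵘ p₁ p₂ q₁ q₂ r₁ r₂ ≃ detᵘ p₁′ p₂′ q₁′ q₂′ r₁′ r₂′
detᵘ-cong e₁ e₂ e₃ e₄ e₅ e₆ =
  -ᵘ-cong (ℚᵘP.*-cong (-ᵘ-cong e₃ e₁) (-ᵘ-cong e₆ e₂)) (ℚᵘP.*-cong (-ᵘ-cong e₄ e₂) (-ᵘ-cong e₅ e₁))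

ιᵘ-det : ∀ p₁ p₂ q₁ q₂ r₁ r₂ →
  ιᵘ (det (p₁ , p₂) (q₁ , q₂) (r₁ , r₂)) ≃ detᵘ (ιᵘ p₁) (ιᵘ p₂) (ιᵘ q₁) (ιᵘ q₂) (ιᵘ r₁) (ιᵘ r₂)
ιᵘ-det p₁ p₂ q₁ q₂ r₁ r₂ =
  ℚᵘP.≃-trans (ιᵘ-- ((q₁ - p₁) * (r₂ - p₂)) ((q₂ - p₂) * (r₁ - p₁)))
    (-ᵘ-cong (ℚᵘP.*-cong (ιᵘ-- q₁ p₁) (ιᵘ-- r₂ p₂)) (ℚᵘP.*-cong (ιᵘ-- q₂ p₂) (ιᵘ-- r₁ p₁)))

Combinationᵘ : Point → Point → Point → Point → ℚᵘ → ℚᵘ → ℚᵘ → Set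
Combinationᵘ (a₁ , a₂) (b₁ , b₂) (c₁ , c₂) (x₁ , x₂) l m n =
  (ιᵘ x₁ ≃ l *ᵘ ιᵘ a₁ +ᵘ m *ᵘ ιᵘ b₁ +ᵘ n *ᵘ ιᵘ c₁) ×
  (ιᵘ x₂ ≃ l *ᵘ ιᵘ a₂ +ᵘ m *ᵘ ιᵘ b₂ +ᵘ n *ᵘ ιᵘ c₂)

private
  toℚᵘ-ι* : ∀ l a → toℚᵘ (l ℚ.* ι a) ≃ toℚᵘ l *ᵘ ιᵘ a
  toℚᵘ-ι* l a = ℚᵘP.≃-trans (ℚP.toℚᵘ-homo-* l (ι a)) (ℚᵘP.*-congˡ {toℚᵘ l} (ℚᵘP.≃-reflexive (toℚᵘ-ι a)))

  toℚᵘ-sum₃ : ∀ p q r → toℚᵘ (p ℚ.+ q ℚ.+ r) ≃ toℚᵘ p +ᵘ toℚᵘ q +ᵘ toℚᵘ r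
  toℚᵘ-sum₃ p q r = ℚᵘP.≃-trans (ℚP.toℚᵘ-homo-+ (p ℚ.+ q) r) (ℚᵘP.+-congˡ (toℚᵘ r) (ℚP.toℚᵘ-homo-+ p q))

  toℚᵘ-comb : ∀ l m n a b c →
    toℚᵘ (l ℚ.* ι a ℚ.+ m ℚ.* ι b ℚ.+ n ℚ.* ι c) ≃ toℚᵘ l *ᵘ ιᵘ a +ᵘ toℚᵘ m *ᵘ ιᵘ b +ᵘ toℚᵘ n *ᵘ ιᵘ c
  toℚᵘ-comb l m n a b c = ℚᵘP.≃-trans (toℚᵘ-sum₃ (l ℚ.* ι a) (m ℚ.* ι b) (n ℚ.* ι c))
    (ℚᵘP.+-cong (ℚᵘP.+-cong (toℚᵘ-ι* l a) (toℚᵘ-ι* m b)) (toℚᵘ-ι* n c))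

toℚᵘ-combination : ∀ a b c x l m n →
  IsCombination a b c x l m n → Combinationᵘ a b c x (toℚᵘ l) (toℚᵘ m) (toℚᵘ n)
toℚᵘ-combination (a₁ , a₂) (b₁ , b₂) (c₁ , c₂) (x₁ , x₂) l m n (e₁ , e₂) = coord e₁ , coord e₂
  where
  coord : ∀ {x a b c} → ι x ≡ l ℚ.* ι a ℚ.+ m ℚ.* ι b ℚ.+ n ℚ.* ι c →
          ιᵘ x ≃ toℚᵘ l *ᵘ ιᵘ a +ᵘ toℚᵘ m *ᵘ ιᵘ b +ᵘ toℚᵘ n *ᵘ ιᵘ c
  coord {x} {a} {b} {c} e =
    ℚᵘP.≃-trans (ℚᵘP.≃-reflexive (trans (sym (toℚᵘ-ι x)) (cong toℚᵘ e))) (toℚᵘ-comb l m n a b c)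

fromℚᵘ-combination : ∀ a b c x l m n →
  Combinationᵘ a b c x l m n → IsCombination a b c x (fromℚᵘ l) (fromℚᵘ m) (fromℚᵘ n)
fromℚᵘ-combination (a₁ , a₂) (b₁ , b₂) (c₁ , c₂) (x₁ , x₂) l m n (e₁ , e₂) = coord e₁ , coord e₂
  where
  coord : ∀ {x a b c} → ιᵘ x ≃ l *ᵘ ιᵘ a +ᵘ m *ᵘ ιᵘ b +ᵘ n *ᵘ ιᵘ c →
          ι x ≡ fromℚᵘ l ℚ.* ι a ℚ.+ fromℚᵘ m ℚ.* ι b ℚ.+ fromℚᵘ n ℚ.* ι c
  coord {x} {a} {b} {c} e = ℚP.toℚᵘ-injective (ℚᵘP.≃-trans (ℚᵘP.≃-reflexive (toℚᵘ-ι x))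
    (ℚᵘP.≃-trans e (ℚᵘP.≃-sym (ℚᵘP.≃-trans (toℚᵘ-comb (fromℚᵘ l) (fromℚᵘ m) (fromℚᵘ n) a b c)
      (ℚᵘP.+-cong (ℚᵘP.+-cong (ℚᵘP.*-congʳ (ℚP.toℚᵘ-fromℚᵘ l)) (ℚᵘP.*-congʳ (ℚP.toℚᵘ-fromℚᵘ m)))
                  (ℚᵘP.*-congʳ (ℚP.toℚᵘ-fromℚᵘ n)))))))

toℚᵘ-sum≡1 : ∀ l m n → l ℚ.+ m ℚ.+ n ≡ 1ℚ → toℚᵘ l +ᵘ toℚᵘ m +ᵘ toℚᵘ n ≃ 1ℚᵘ
toℚᵘ-sum≡1 l m n s = ℚᵘP.≃-trans (ℚᵘP.≃-sym (toℚᵘ-sum₃ l m n)) (ℚᵘP.≃-reflexive (cong toℚᵘ s))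

fromℚᵘ-sum≡1 : ∀ l m n → l +ᵘ m +ᵘ n ≃ 1ℚᵘ → fromℚᵘ l ℚ.+ fromℚᵘ m ℚ.+ fromℚᵘ n ≡ 1ℚ
fromℚᵘ-sum≡1 l m n s = ℚP.toℚᵘ-injective (ℚᵘP.≃-trans (toℚᵘ-sum₃ (fromℚᵘ l) (fromℚᵘ m) (fromℚᵘ n))
  (ℚᵘP.≃-trans (ℚᵘP.+-cong (ℚᵘP.+-cong (ℚP.toℚᵘ-fromℚᵘ l) (ℚP.toℚᵘ-fromℚᵘ m)) (ℚP.toℚᵘ-fromℚᵘ n)) s))

private
  -- The identities hold for arbitrary weights; the error term vanishes when l + m + n = 1.
  barycentric₁ : ∀ l m n a₁ a₂ b₁ b₂ c₁ c₂ →
    let x₁ = l *ᵘ a₁ +ᵘ m *ᵘ b₁ +ᵘ n *ᵘ c₁ ; x₂ = l *ᵘ a₂ +ᵘ m *ᵘ b₂ +ᵘ n *ᵘ c₂ in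
    (b₁ -ᵘ x₁) *ᵘ (c₂ -ᵘ x₂) -ᵘ (b₂ -ᵘ x₂) *ᵘ (c₁ -ᵘ x₁)
    ≃ l *ᵘ ((b₁ -ᵘ a₁) *ᵘ (c₂ -ᵘ a₂) -ᵘ (b₂ -ᵘ a₂) *ᵘ (c₁ -ᵘ a₁)) +ᵘ (1ℚᵘ -ᵘ (l +ᵘ m +ᵘ n)) *ᵘ (b₁ *ᵘ c₂ -ᵘ b₂ *ᵘ c₁)
  barycentric₁ = RingSolver.solve-∀ ℚᵘ-ring
  barycentric₂ : ∀ l m n a₁ a₂ b₁ b₂ c₁ c₂ →
    let x₁ = l *ᵘ a₁ +ᵘ m *ᵘ b₁ +ᵘ n *ᵘ c₁ ; x₂ = l *ᵘ a₂ +ᵘ m *ᵘ b₂ +ᵘ n *ᵘ c₂ in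
    (x₁ -ᵘ a₁) *ᵘ (c₂ -ᵘ a₂) -ᵘ (x₂ -ᵘ a₂) *ᵘ (c₁ -ᵘ a₁)
    ≃ m *ᵘ ((b₁ -ᵘ a₁) *ᵘ (c₂ -ᵘ a₂) -ᵘ (b₂ -ᵘ a₂) *ᵘ (c₁ -ᵘ a₁)) +ᵘ (1ℚᵘ -ᵘ (l +ᵘ m +ᵘ n)) *ᵘ (c₁ *ᵘ a₂ -ᵘ c₂ *ᵘ a₁)
  barycentric₂ = RingSolver.solve-∀ ℚᵘ-ring
  barycentric₃ : ∀ l m n a₁ a₂ b₁ b₂ c₁ c₂ →
    let x₁ = l *ᵘ a₁ +ᵘ m *ᵘ b₁ +ᵘ n *ᵘ c₁ ; x₂ = l *ᵘ a₂ +ᵘ m *ᵘ b₂ +ᵘ n *ᵘ c₂ in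
    (b₁ -ᵘ a₁) *ᵘ (x₂ -ᵘ a₂) -ᵘ (b₂ -ᵘ a₂) *ᵘ (x₁ -ᵘ a₁)
    ≃ n *ᵘ ((b₁ -ᵘ a₁) *ᵘ (c₂ -ᵘ a₂) -ᵘ (b₂ -ᵘ a₂) *ᵘ (c₁ -ᵘ a₁)) +ᵘ (1ℚᵘ -ᵘ (l +ᵘ m +ᵘ n)) *ᵘ (a₁ *ᵘ b₂ -ᵘ a₂ *ᵘ b₁)
  barycentric₃ = RingSolver.solve-∀ ℚᵘ-ring
  no-error-term : ∀ X Y → X +ᵘ (1ℚᵘ -ᵘ 1ℚᵘ) *ᵘ Y ≃ X
  no-error-term = RingSolver.solve-∀ ℚᵘ-ring

barycentric-det : ∀ a₁ a₂ b₁ b₂ c₁ c₂ x₁ x₂ l m n →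
  Combinationᵘ (a₁ , a₂) (b₁ , b₂) (c₁ , c₂) (x₁ , x₂) l m n → l +ᵘ m +ᵘ n ≃ 1ℚᵘ →
  let D = det (a₁ , a₂) (b₁ , b₂) (c₁ , c₂) in
  (ιᵘ (det (x₁ , x₂) (b₁ , b₂) (c₁ , c₂)) ≃ l *ᵘ ιᵘ D) ×
  (ιᵘ (det (a₁ , a₂) (x₁ , x₂) (c₁ , c₂)) ≃ m *ᵘ ιᵘ D) ×
  (ιᵘ (det (a₁ , a₂) (b₁ , b₂) (x₁ , x₂)) ≃ n *ᵘ ιᵘ D)
barycentric-det a₁ a₂ b₁ b₂ c₁ c₂ x₁ x₂ l m n (e₁ , e₂) s =
  weight l (ιᵘ-det x₁ x₂ b₁ b₂ c₁ c₂) (detᵘ-cong e₁ e₂ (r B₁) (r B₂) (r C₁) (r C₂))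
    (barycentric₁ l m n A₁ A₂ B₁ B₂ C₁ C₂) ,
  weight m (ιᵘ-det a₁ a₂ x₁ x₂ c₁ c₂) (detᵘ-cong (r A₁) (r A₂) e₁ e₂ (r C₁) (r C₂))
    (barycentric₂ l m n A₁ A₂ B₁ B₂ C₁ C₂) ,
  weight n (ιᵘ-det a₁ a₂ b₁ b₂ x₁ x₂) (detᵘ-cong (r A₁) (r A₂) (r B₁) (r B₂) e₁ e₂)
    (barycentric₃ l m n A₁ A₂ B₁ B₂ C₁ C₂)
  where
  A₁ = ιᵘ a₁ ; A₂ = ιᵘ a₂ ; B₁ = ιᵘ b₁ ; B₂ = ιᵘ b₂ ; C₁ = ιᵘ c₁ ; C₂ = ιᵘ c₂
  r : ∀ p → p ≃ p
  r p = ℚᵘP.≃-refl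
  Δ = detᵘ A₁ A₂ B₁ B₂ C₁ C₂

  weight : ∀ w {E P Q Y} → ιᵘ E ≃ P → P ≃ Q → Q ≃ w *ᵘ Δ +ᵘ (1ℚᵘ -ᵘ (l +ᵘ m +ᵘ n)) *ᵘ Y →
           ιᵘ E ≃ w *ᵘ ιᵘ (det (a₁ , a₂) (b₁ , b₂) (c₁ , c₂))
  weight w {Y = Y} p q t = ℚᵘP.≃-trans p (ℚᵘP.≃-trans q (ℚᵘP.≃-trans t
    (ℚᵘP.≃-trans (ℚᵘP.+-congʳ (w *ᵘ Δ) (ℚᵘP.*-congʳ (-ᵘ-cong (r 1ℚᵘ) s)))
    (ℚᵘP.≃-trans (no-error-term (w *ᵘ Δ) Y) (ℚᵘP.*-congˡ {w} (ℚᵘP.≃-sym (ιᵘ-det a₁ a₂ b₁ b₂ c₁ c₂)))))))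

0≤i+j : ∀ {i j} → 0ℤ ℤ.≤ i → 0ℤ ℤ.≤ j → 0ℤ ℤ.≤ i + j
0≤i+j = ℤP.+-mono-≤

0≤i*j : ∀ {i j} → 0ℤ ℤ.≤ i → 0ℤ ℤ.≤ j → 0ℤ ℤ.≤ i * j
0≤i*j {+ m} {+ n} _ _ = subst (0ℤ ℤ.≤_) (ℤP.pos-* m n) (+≤+ z≤n)

0<i*j : ∀ {i j} → 0ℤ ℤ.< i → 0ℤ ℤ.< j → 0ℤ ℤ.< i * j
0<i*j {+[1+ m ]} {+[1+ n ]} _ _ = +<+ (s≤s z≤n)
0<i*j {+ zero} (+<+ ()) _
0<i*j {+[1+ m ]} {+ zero} _ (+<+ ())

ratio-nonneg : ∀ E D l → ιᵘ E ≃ l *ᵘ ιᵘ D → 0ℚᵘ ≤ᵘ l → 0ℤ ℤ.< D → 0ℤ ℤ.≤ E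
ratio-nonneg E D (mkℚᵘ n d) (*≡* eq) (*≤* 0≤n) 0<D = ℤP.*-cancelʳ-≤-pos 0ℤ E +[1+ d ℕ.* 1 ]
  (subst (0ℤ ℤ.≤_) (sym (trans eq (ℤP.*-identityʳ (n * D))))
    (0≤i*j (subst (0ℤ ℤ.≤_) (ℤP.*-identityʳ n) 0≤n) (ℤP.<⇒≤ 0<D)))

ratio-pos : ∀ E D l → ιᵘ E ≃ l *ᵘ ιᵘ D → 0ℚᵘ <ᵘ l → 0ℤ ℤ.< D → 0ℤ ℤ.< E
ratio-pos E D (mkℚᵘ n d) (*≡* eq) (*<* 0<n) 0<D = ℤP.*-cancelʳ-<-nonNeg +[1+ d ℕ.* 1 ]
  (subst (0ℤ ℤ.<_) (sym (trans eq (ℤP.*-identityʳ (n * D))))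
    (0<i*j (subst (0ℤ ℤ.<_) (ℤP.*-identityʳ n) 0<n) 0<D))

inHull⇒det-nonneg : ∀ a b c x → 0ℤ ℤ.< det a b c → InHull a b c x →
  (0ℤ ℤ.≤ det x b c) × (0ℤ ℤ.≤ det a x c) × (0ℤ ℤ.≤ det a b x)
inHull⇒det-nonneg (a₁ , a₂) (b₁ , b₂) (c₁ , c₂) (x₁ , x₂) 0<D (l , m , n , 0≤l , 0≤m , 0≤n , s , cm) =
  ratio-nonneg _ _ _ (proj₁ e) (ℚP.toℚᵘ-mono-≤ 0≤l) 0<D ,
  ratio-nonneg _ _ _ (proj₁ (proj₂ e)) (ℚP.toℚᵘ-mono-≤ 0≤m) 0<D ,
  ratio-nonneg _ _ _ (proj₂ (proj₂ e)) (ℚP.toℚᵘ-mono-≤ 0≤n) 0<D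
  where
  e = barycentric-det a₁ a₂ b₁ b₂ c₁ c₂ x₁ x₂ (toℚᵘ l) (toℚᵘ m) (toℚᵘ n)
        (toℚᵘ-combination _ _ _ _ l m n cm) (toℚᵘ-sum≡1 l m n s)

inInterior⇒det-pos : ∀ a b c x → 0ℤ ℤ.< det a b c → InInterior a b c x →
  (0ℤ ℤ.< det x b c) × (0ℤ ℤ.< det a x c) × (0ℤ ℤ.< det a b x)
inInterior⇒det-pos (a₁ , a₂) (b₁ , b₂) (c₁ , c₂) (x₁ , x₂) 0<D (l , m , n , 0<l , 0<m , 0<n , s , cm) =
  ratio-pos _ _ _ (proj₁ e) (ℚP.toℚᵘ-mono-< 0<l) 0<D ,
  ratio-pos _ _ _ (proj₁ (proj₂ e)) (ℚP.toℚᵘ-mono-< 0<m) 0<D ,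
  ratio-pos _ _ _ (proj₂ (proj₂ e)) (ℚP.toℚᵘ-mono-< 0<n) 0<D
  where
  e = barycentric-det a₁ a₂ b₁ b₂ c₁ c₂ x₁ x₂ (toℚᵘ l) (toℚᵘ m) (toℚᵘ n)
        (toℚᵘ-combination _ _ _ _ l m n cm) (toℚᵘ-sum≡1 l m n s)

module IntegerWeights (a₁ a₂ b₁ b₂ c₁ c₂ x₁ x₂ A B C : ℤ) (k : ℕ)
  (sum : A + B + C ≡ +[1+ k ])
  (comb₁ : +[1+ k ] * x₁ ≡ A * a₁ + B * b₁ + C * c₁)
  (comb₂ : +[1+ k ] * x₂ ≡ A * a₂ + B * b₂ + C * c₂) where

  private
    1/N : ℚᵘ
    1/N = mkℚᵘ 1ℤ k

    N*1/N : ιᵘ +[1+ k ] *ᵘ 1/N ≃ 1ℚᵘ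
    N*1/N = *≡* (trans (ℤP.*-identityʳ _) (trans (ℤP.*-identityʳ _)
      (trans (cong +_ (sym (ℕP.*-identityˡ (suc k)))) (sym (ℤP.*-identityˡ _)))))

    weight : ℤ → ℚᵘ
    weight W = ιᵘ W *ᵘ 1/N

    weight-sum : weight A +ᵘ weight B +ᵘ weight C ≃ 1ℚᵘ
    weight-sum = ℚᵘP.≃-trans (factor (ιᵘ A) (ιᵘ B) (ιᵘ C) 1/N)
      (ℚᵘP.≃-trans (ℚᵘP.*-congʳ (ℚᵘP.≃-sym (ℚᵘP.≃-trans (ιᵘ-+ (A + B) C) (ℚᵘP.+-congˡ (ιᵘ C) (ιᵘ-+ A B)))))
      (ℚᵘP.≃-trans (ℚᵘP.*-congʳ (ℚᵘP.≃-reflexive (cong ιᵘ sum))) N*1/N))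
      where
      factor : ∀ a b c v → a *ᵘ v +ᵘ b *ᵘ v +ᵘ c *ᵘ v ≃ (a +ᵘ b +ᵘ c) *ᵘ v
      factor = RingSolver.solve-∀ ℚᵘ-ring

    coord : ∀ a b c x → +[1+ k ] * x ≡ A * a + B * b + C * c →
            ιᵘ x ≃ weight A *ᵘ ιᵘ a +ᵘ weight B *ᵘ ιᵘ b +ᵘ weight C *ᵘ ιᵘ c
    coord a b c x e = ℚᵘP.≃-sym
      (ℚᵘP.≃-trans (regroup (ιᵘ A) (ιᵘ B) (ιᵘ C) 1/N (ιᵘ a) (ιᵘ b) (ιᵘ c))
      (ℚᵘP.≃-trans (ℚᵘP.*-congˡ {1/N} (ℚᵘP.≃-sym ιᵘ-rhs))
      (ℚᵘP.≃-trans (ℚᵘP.*-congˡ {1/N} (ℚᵘP.≃-reflexive (cong ιᵘ (sym e))))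
      (ℚᵘP.≃-trans (cancel 1/N (ιᵘ +[1+ k ]) (ιᵘ x))
      (ℚᵘP.≃-trans (ℚᵘP.*-congʳ N*1/N) (ℚᵘP.*-identityˡ (ιᵘ x)))))))
      where
      ιᵘ-rhs : ιᵘ (A * a + B * b + C * c) ≃ ιᵘ A *ᵘ ιᵘ a +ᵘ ιᵘ B *ᵘ ιᵘ b +ᵘ ιᵘ C *ᵘ ιᵘ c
      ιᵘ-rhs = ℚᵘP.≃-trans (ιᵘ-+ (A * a + B * b) (C * c)) (ℚᵘP.+-congˡ (ιᵘ C *ᵘ ιᵘ c) (ιᵘ-+ (A * a) (B * b)))
      regroup : ∀ A B C v a b c →
        (A *ᵘ v) *ᵘ a +ᵘ (B *ᵘ v) *ᵘ b +ᵘ (C *ᵘ v) *ᵘ c ≃ v *ᵘ (A *ᵘ a +ᵘ B *ᵘ b +ᵘ C *ᵘ c)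
      regroup = RingSolver.solve-∀ ℚᵘ-ring
      cancel : ∀ v N x → v *ᵘ (N *ᵘ x) ≃ (N *ᵘ v) *ᵘ x
      cancel = RingSolver.solve-∀ ℚᵘ-ring

    combination : IsCombination (a₁ , a₂) (b₁ , b₂) (c₁ , c₂) (x₁ , x₂)
                    (fromℚᵘ (weight A)) (fromℚᵘ (weight B)) (fromℚᵘ (weight C))
    combination = fromℚᵘ-combination _ _ _ _ (weight A) (weight B) (weight C)
      (coord a₁ b₁ c₁ x₁ comb₁ , coord a₂ b₂ c₂ x₂ comb₂)

    weight-nonneg : ∀ W → 0ℤ ℤ.≤ W → 0ℚ ℚ.≤ fromℚᵘ (weight W)
    weight-nonneg W 0≤W = ℚP.toℚᵘ-cancel-≤ (ℚᵘP.≤-respʳ-≃ (ℚᵘP.≃-sym (ℚP.toℚᵘ-fromℚᵘ (weight W)))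
      (*≤* (subst (0ℤ ℤ.≤_) (sym (trans (ℤP.*-identityʳ _) (ℤP.*-identityʳ W))) 0≤W)))

    weight-pos : ∀ W → 0ℤ ℤ.< W → 0ℚ ℚ.< fromℚᵘ (weight W)
    weight-pos W 0<W = ℚP.toℚᵘ-cancel-< (ℚᵘP.<-respʳ-≃ (ℚᵘP.≃-sym (ℚP.toℚᵘ-fromℚᵘ (weight W)))
      (*<* (subst (0ℤ ℤ.<_) (sym (trans (ℤP.*-identityʳ _) (ℤP.*-identityʳ W))) 0<W)))

  inHull : 0ℤ ℤ.≤ A → 0ℤ ℤ.≤ B → 0ℤ ℤ.≤ C → InHull (a₁ , a₂) (b₁ , b₂) (c₁ , c₂) (x₁ , x₂)
  inHull 0≤A 0≤B 0≤C = fromℚᵘ (weight A) , fromℚᵘ (weight B) , fromℚᵘ (weight C) ,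
    weight-nonneg A 0≤A , weight-nonneg B 0≤B , weight-nonneg C 0≤C ,
    fromℚᵘ-sum≡1 (weight A) (weight B) (weight C) weight-sum , combination

  inInterior : 0ℤ ℤ.< A → 0ℤ ℤ.< B → 0ℤ ℤ.< C → InInterior (a₁ , a₂) (b₁ , b₂) (c₁ , c₂) (x₁ , x₂)
  inInterior 0<A 0<B 0<C = fromℚᵘ (weight A) , fromℚᵘ (weight B) , fromℚᵘ (weight C) ,
    weight-pos A 0<A , weight-pos B 0<B , weight-pos C 0<C ,
    fromℚᵘ-sum≡1 (weight A) (weight B) (weight C) weight-sum , combination

record BézoutGcd (a b : ℤ) : Set where
  field
    gcd : ℕ
    s t : ℤ
    identity : s * a + t * b ≡ + gcd
    gcd∣a : + gcd ∣ a
    gcd∣b : + gcd ∣ b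

private
  ∣-pos : ∀ {g m} → g ℕD.∣ m → + g ∣ + m
  ∣-pos {g} (ℕD.divides q refl) = divides (+ q) (ℤP.pos-* q g)

  identity-pos : ∀ {g m n} → Bézout.Identity g m n → ∃ λ s → ∃ λ t → s * + m + t * + n ≡ + g
  identity-pos {g} {m} {n} (Bézout.+- x y eq) = + x , - + y ,
    trans (cong (_+ - + y * + n) (lift {g} {y} {n} {x} {m} eq)) (cancel (+ g) (+ y) (+ n))
    where
    lift : ∀ {g y n x m} → g ℕ.+ y ℕ.* n ≡ x ℕ.* m → + x * + m ≡ + g + + y * + n
    lift {g} {y} {n} {x} {m} eq = trans (sym (ℤP.pos-* x m))
      (trans (cong +_ (sym eq)) (trans (ℤP.pos-+ g (y ℕ.* n)) (cong (λ z → + g + z) (ℤP.pos-* y n))))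
    cancel : ∀ g y n → g + y * n + - y * n ≡ g
    cancel = solve-∀
  identity-pos {g} {m} {n} (Bézout.-+ x y eq) = - + x , + y ,
    trans (cong (λ z → - + x * + m + z) (lift {g} {x} {m} {y} {n} eq)) (cancel (+ g) (+ x) (+ m))
    where
    lift : ∀ {g x m y n} → g ℕ.+ x ℕ.* m ≡ y ℕ.* n → + y * + n ≡ + g + + x * + m
    lift {g} {x} {m} {y} {n} eq = trans (sym (ℤP.pos-* y n))
      (trans (cong +_ (sym eq)) (trans (ℤP.pos-+ g (x ℕ.* m)) (cong (λ z → + g + z) (ℤP.pos-* x m))))
    cancel : ∀ g x m → - x * m + (g + x * m) ≡ g
    cancel = solve-∀

  bézoutGcd-pos : ∀ m n → BézoutGcd (+ m) (+ n)
  bézoutGcd-pos m n with Bézout.lemma m n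
  ... | Bézout.result g (GCD.is (g∣m , g∣n) _) iden with identity-pos iden
  ...   | s , t , eq = record { gcd = g ; s = s ; t = t ; identity = eq ; gcd∣a = ∣-pos g∣m ; gcd∣b = ∣-pos g∣n }

  negate-first : ∀ {a b} → BézoutGcd a b → BézoutGcd (- a) b
  negate-first {a} {b} r = record
    { gcd = gcd ; s = - s ; t = t ; identity = trans (flip s a t b) identity ; gcd∣a = ∣m⇒∣-m gcd∣a ; gcd∣b = gcd∣b }
    where
    open BézoutGcd r
    flip : ∀ s a t b → - s * - a + t * b ≡ s * a + t * b
    flip = solve-∀

  negate-second : ∀ {a b} → BézoutGcd a b → BézoutGcd a (- b)
  negate-second {a} {b} r = record
    { gcd = gcd ; s = s ; t = - t ; identity = trans (flip s a t b) identity ; gcd∣a = gcd∣a ; gcd∣b = ∣m⇒∣-m gcd∣b }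
    where
    open BézoutGcd r
    flip : ∀ s a t b → s * a + - t * - b ≡ s * a + t * b
    flip = solve-∀

bézoutGcd : ∀ a b → BézoutGcd a b
bézoutGcd (+ m) (+ n) = bézoutGcd-pos m n
bézoutGcd (+ m) -[1+ n ] = negate-second (bézoutGcd-pos m (suc n))
bézoutGcd -[1+ m ] (+ n) = negate-first (bézoutGcd-pos (suc m) n)
bézoutGcd -[1+ m ] -[1+ n ] = negate-first (negate-second (bézoutGcd-pos (suc m) (suc n)))

-- Internal triangles

Among : Point → Point → Point → Point → Point → Set
Among a b c d x = (x ≡ a) ⊎ (x ≡ b) ⊎ (x ≡ c) ⊎ (x ≡ d)

weights⇒inHull : ∀ a₁ a₂ b₁ b₂ c₁ c₂ x₁ x₂ A B C N →
  0ℤ ℤ.≤ A → 0ℤ ℤ.≤ B → 0ℤ ℤ.≤ C → 0ℤ ℤ.< N → A + B + C ≡ N →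
  N * x₁ ≡ A * a₁ + B * b₁ + C * c₁ → N * x₂ ≡ A * a₂ + B * b₂ + C * c₂ →
  InHull (a₁ , a₂) (b₁ , b₂) (c₁ , c₂) (x₁ , x₂)
weights⇒inHull a₁ a₂ b₁ b₂ c₁ c₂ x₁ x₂ A B C +[1+ k ] 0≤A 0≤B 0≤C _ sum e₁ e₂ =
  IntegerWeights.inHull a₁ a₂ b₁ b₂ c₁ c₂ x₁ x₂ A B C k sum e₁ e₂ 0≤A 0≤B 0≤C
weights⇒inHull _ _ _ _ _ _ _ _ _ _ _ (+ zero) _ _ _ (+<+ ()) _ _ _
weights⇒inHull _ _ _ _ _ _ _ _ _ _ _ -[1+ _ ] _ _ _ () _ _ _

det-cyclic : ∀ p q r → det p q r ≡ det q r p
det-cyclic (p₁ , p₂) (q₁ , q₂) (r₁ , r₂) = lemma p₁ p₂ q₁ q₂ r₁ r₂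
  where
  lemma : ∀ p₁ p₂ q₁ q₂ r₁ r₂ →
    (q₁ - p₁) * (r₂ - p₂) - (q₂ - p₂) * (r₁ - p₁) ≡ (r₁ - q₁) * (p₂ - q₂) - (r₂ - q₂) * (p₁ - q₁)
  lemma = solve-∀

det-split : ∀ a b c x → det a b c ≡ det x b c + det a x c + det a b x
det-split (a₁ , a₂) (b₁ , b₂) (c₁ , c₂) (x₁ , x₂) = lemma a₁ a₂ b₁ b₂ c₁ c₂ x₁ x₂
  where
  lemma : ∀ a₁ a₂ b₁ b₂ c₁ c₂ x₁ x₂ →
    (b₁ - a₁) * (c₂ - a₂) - (b₂ - a₂) * (c₁ - a₁) ≡
    ((b₁ - x₁) * (c₂ - x₂) - (b₂ - x₂) * (c₁ - x₁)) + ((x₁ - a₁) * (c₂ - a₂) - (x₂ - a₂) * (c₁ - a₁))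
      + ((b₁ - a₁) * (x₂ - a₂) - (b₂ - a₂) * (x₁ - a₁))
  lemma = solve-∀

cramer : ∀ a₁ a₂ b₁ b₂ c₁ c₂ x₁ x₂ →
  let a = (a₁ , a₂) ; b = (b₁ , b₂) ; c = (c₁ , c₂) ; x = (x₁ , x₂) in
  (det a b c * x₁ ≡ det x b c * a₁ + det a x c * b₁ + det a b x * c₁) ×
  (det a b c * x₂ ≡ det x b c * a₂ + det a x c * b₂ + det a b x * c₂)
cramer a₁ a₂ b₁ b₂ c₁ c₂ x₁ x₂ = lemma₁ a₁ a₂ b₁ b₂ c₁ c₂ x₁ x₂ , lemma₂ a₁ a₂ b₁ b₂ c₁ c₂ x₁ x₂
  where
  lemma₂ : ∀ a₁ a₂ b₁ b₂ c₁ c₂ x₁ x₂ →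
    ((b₁ - a₁) * (c₂ - a₂) - (b₂ - a₂) * (c₁ - a₁)) * x₂ ≡
    ((b₁ - x₁) * (c₂ - x₂) - (b₂ - x₂) * (c₁ - x₁)) * a₂ + ((x₁ - a₁) * (c₂ - a₂) - (x₂ - a₂) * (c₁ - a₁)) * b₂
      + ((b₁ - a₁) * (x₂ - a₂) - (b₂ - a₂) * (x₁ - a₁)) * c₂
  lemma₂ = solve-∀
  lemma₁ : ∀ a₁ a₂ b₁ b₂ c₁ c₂ x₁ x₂ →
    ((b₁ - a₁) * (c₂ - a₂) - (b₂ - a₂) * (c₁ - a₁)) * x₁ ≡
    ((b₁ - x₁) * (c₂ - x₂) - (b₂ - x₂) * (c₁ - x₁)) * a₁ + ((x₁ - a₁) * (c₂ - a₂) - (x₂ - a₂) * (c₁ - a₁)) * b₁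
      + ((b₁ - a₁) * (x₂ - a₂) - (b₂ - a₂) * (x₁ - a₁)) * c₁
  lemma₁ = solve-∀

cross-expansion : ∀ u₁ u₂ v₁ v₂ y₁ y₂ →
  ((u₁ * v₂ - u₂ * v₁) * y₁ ≡ (y₁ * v₂ - y₂ * v₁) * u₁ + (u₁ * y₂ - u₂ * y₁) * v₁) ×
  ((u₁ * v₂ - u₂ * v₁) * y₂ ≡ (y₁ * v₂ - y₂ * v₁) * u₂ + (u₁ * y₂ - u₂ * y₁) * v₂)
cross-expansion u₁ u₂ v₁ v₂ y₁ y₂ = first u₁ u₂ v₁ v₂ y₁ y₂ , second u₁ u₂ v₁ v₂ y₁ y₂
  where
  first : ∀ u₁ u₂ v₁ v₂ y₁ y₂ → (u₁ * v₂ - u₂ * v₁) * y₁ ≡ (y₁ * v₂ - y₂ * v₁) * u₁ + (u₁ * y₂ - u₂ * y₁) * v₁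
  first = solve-∀
  second : ∀ u₁ u₂ v₁ v₂ y₁ y₂ → (u₁ * v₂ - u₂ * v₁) * y₂ ≡ (y₁ * v₂ - y₂ * v₁) * u₂ + (u₁ * y₂ - u₂ * y₁) * v₂
  second = solve-∀

private
  3*z≢1 : ∀ z → + 3 * z ≢ 1ℤ
  3*z≢1 (+ zero) ()
  3*z≢1 +[1+ zero ] ()
  3*z≢1 +[1+ suc k ] ()
  3*z≢1 -[1+ k ] ()

  3*z≢2 : ∀ z → + 3 * z ≢ + 2
  3*z≢2 (+ zero) ()
  3*z≢2 +[1+ zero ] ()
  3*z≢2 +[1+ suc zero ] ()
  3*z≢2 +[1+ suc (suc k) ] ()
  3*z≢2 -[1+ k ] ()

  3*z≢-1 : ∀ z → + 3 * z ≢ -1ℤ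
  3*z≢-1 (+ zero) ()
  3*z≢-1 +[1+ k ] ()
  3*z≢-1 -[1+ zero ] ()
  3*z≢-1 -[1+ suc k ] ()

  3*z≢-2 : ∀ z → + 3 * z ≢ -[1+ 1 ]
  3*z≢-2 (+ zero) ()
  3*z≢-2 +[1+ k ] ()
  3*z≢-2 -[1+ zero ] ()
  3*z≢-2 -[1+ suc zero ] ()
  3*z≢-2 -[1+ suc (suc k) ] ()

  3*-injective : ∀ {z w} → + 3 * z ≡ + 3 * w → z ≡ w
  3*-injective {z} {w} = ℤP.*-cancelˡ-≡ (+ 3) z w

-- A lattice point x of the triangle d + u, d + v, d - u - v with det(u, v) = 1 has x - d = p u + q v,
-- where 3p = e₁ - e₃ and 3q = e₂ - e₃ for its barycentric coordinates eᵢ/3; only the vertices and the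
-- centre survive.
compositions-of-3 : ∀ e₁ e₂ e₃ p q → e₁ ℕ.+ e₂ ℕ.+ e₃ ≡ 3 →
  + 3 * p ≡ + e₁ - + e₃ → + 3 * q ≡ + e₂ - + e₃ →
  (p ≡ 0ℤ × q ≡ 0ℤ) ⊎ (p ≡ 1ℤ × q ≡ 0ℤ) ⊎ (p ≡ 0ℤ × q ≡ 1ℤ) ⊎ (p ≡ -1ℤ × q ≡ -1ℤ)
compositions-of-3 1 1 .1 p q refl hp hq = inj₁ (3*-injective hp , 3*-injective hq)
compositions-of-3 3 0 .0 p q refl hp hq = inj₂ (inj₁ (3*-injective hp , 3*-injective hq))
compositions-of-3 0 3 .0 p q refl hp hq = inj₂ (inj₂ (inj₁ (3*-injective hp , 3*-injective hq)))
compositions-of-3 0 0 .3 p q refl hp hq = inj₂ (inj₂ (inj₂ (3*-injective hp , 3*-injective hq)))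
compositions-of-3 2 1 .0 p q refl hp hq = ⊥-elim (3*z≢2 p hp)
compositions-of-3 2 0 .1 p q refl hp hq = ⊥-elim (3*z≢1 p hp)
compositions-of-3 1 2 .0 p q refl hp hq = ⊥-elim (3*z≢1 p hp)
compositions-of-3 1 0 .2 p q refl hp hq = ⊥-elim (3*z≢-1 p hp)
compositions-of-3 0 2 .1 p q refl hp hq = ⊥-elim (3*z≢-1 p hp)
compositions-of-3 0 1 .2 p q refl hp hq = ⊥-elim (3*z≢-2 p hp)
compositions-of-3 (suc (suc (suc (suc _)))) _ _ p q () hp hq
compositions-of-3 3 (suc _) _ p q () hp hq
compositions-of-3 2 (suc (suc _)) _ p q () hp hq
compositions-of-3 1 (suc (suc (suc _))) _ p q () hp hq
compositions-of-3 0 (suc (suc (suc (suc _)))) _ p q () hp hq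

module UnimodularTriangle (d₁ d₂ u₁ u₂ v₁ v₂ : ℤ) (unimodular : u₁ * v₂ - u₂ * v₁ ≡ 1ℤ) where

  a b c d : Point
  a = (d₁ + u₁ , d₂ + u₂)
  b = (d₁ + v₁ , d₂ + v₂)
  c = (d₁ - u₁ - v₁ , d₂ - u₂ - v₂)
  d = (d₁ , d₂)

  det≡3 : det a b c ≡ + 3
  det≡3 = trans (lemma d₁ d₂ u₁ u₂ v₁ v₂) (cong (+ 3 *_) unimodular)
    where
    lemma : ∀ d₁ d₂ u₁ u₂ v₁ v₂ →
      ((d₁ + v₁) - (d₁ + u₁)) * ((d₂ - u₂ - v₂) - (d₂ + u₂)) - ((d₂ + v₂) - (d₂ + u₂)) * ((d₁ - u₁ - v₁) - (d₁ + u₁))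
      ≡ + 3 * (u₁ * v₂ - u₂ * v₁)
    lemma = solve-∀

  interior : InInterior a b c d
  interior = IntegerWeights.inInterior
    (d₁ + u₁) (d₂ + u₂) (d₁ + v₁) (d₂ + v₂) (d₁ - u₁ - v₁) (d₂ - u₂ - v₂) d₁ d₂ 1ℤ 1ℤ 1ℤ 2 refl
    (centroid d₁ u₁ v₁) (centroid d₂ u₂ v₂) (+<+ (s≤s z≤n)) (+<+ (s≤s z≤n)) (+<+ (s≤s z≤n))
    where
    centroid : ∀ d u v → + 3 * d ≡ 1ℤ * (d + u) + 1ℤ * (d + v) + 1ℤ * (d - u - v)
    centroid = solve-∀

  -- Coordinates of x - d in the basis u, v.
  along-u along-v : ℤ → ℤ → ℤ
  along-u x₁ x₂ = (x₁ - d₁) * v₂ - (x₂ - d₂) * v₁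
  along-v x₁ x₂ = u₁ * (x₂ - d₂) - u₂ * (x₁ - d₁)

  point : ℤ → ℤ → Point
  point p q = (d₁ + (p * u₁ + q * v₁) , d₂ + (p * u₂ + q * v₂))

  expansion : ∀ x₁ x₂ → (x₁ , x₂) ≡ point (along-u x₁ x₂) (along-v x₁ x₂)
  expansion x₁ x₂ = cong₂ _,_
    (coord d₁ x₁ (proj₁ (cross-expansion u₁ u₂ v₁ v₂ (x₁ - d₁) (x₂ - d₂))))
    (coord d₂ x₂ (proj₂ (cross-expansion u₁ u₂ v₁ v₂ (x₁ - d₁) (x₂ - d₂))))
    where
    coord : ∀ d x {w} → (u₁ * v₂ - u₂ * v₁) * (x - d) ≡ w → x ≡ d + w
    coord d x {w} e = begin
      x                                   ≡⟨ shift d x ⟩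
      d + 1ℤ * (x - d)                    ≡⟨ cong (λ k → d + k * (x - d)) (sym unimodular) ⟩
      d + (u₁ * v₂ - u₂ * v₁) * (x - d)   ≡⟨ cong (λ z → d + z) e ⟩
      d + w                               ∎
      where
      open ≡-Reasoning
      shift : ∀ d x → x ≡ d + 1ℤ * (x - d)
      shift = solve-∀

  point-d : point 0ℤ 0ℤ ≡ d
  point-d = cong₂ _,_ (lemma d₁ u₁ v₁) (lemma d₂ u₂ v₂)
    where
    lemma : ∀ d u v → d + (0ℤ * u + 0ℤ * v) ≡ d
    lemma = solve-∀

  point-a : point 1ℤ 0ℤ ≡ a
  point-a = cong₂ _,_ (lemma d₁ u₁ v₁) (lemma d₂ u₂ v₂)
    where
    lemma : ∀ d u v → d + (1ℤ * u + 0ℤ * v) ≡ d + u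
    lemma = solve-∀

  point-b : point 0ℤ 1ℤ ≡ b
  point-b = cong₂ _,_ (lemma d₁ u₁ v₁) (lemma d₂ u₂ v₂)
    where
    lemma : ∀ d u v → d + (0ℤ * u + 1ℤ * v) ≡ d + v
    lemma = solve-∀

  point-c : point -1ℤ -1ℤ ≡ c
  point-c = cong₂ _,_ (lemma d₁ u₁ v₁) (lemma d₂ u₂ v₂)
    where
    lemma : ∀ d u v → d + (-1ℤ * u + -1ℤ * v) ≡ d - u - v
    lemma = solve-∀

  3*along-u : ∀ x₁ x₂ → + 3 * along-u x₁ x₂ ≡ det (x₁ , x₂) b c - det a b (x₁ , x₂)
  3*along-u x₁ x₂ = lemma d₁ d₂ u₁ u₂ v₁ v₂ x₁ x₂
    where
    lemma : ∀ d₁ d₂ u₁ u₂ v₁ v₂ x₁ x₂ →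
      + 3 * ((x₁ - d₁) * v₂ - (x₂ - d₂) * v₁) ≡
      (((d₁ + v₁) - x₁) * ((d₂ - u₂ - v₂) - x₂) - ((d₂ + v₂) - x₂) * ((d₁ - u₁ - v₁) - x₁))
      - (((d₁ + v₁) - (d₁ + u₁)) * (x₂ - (d₂ + u₂)) - ((d₂ + v₂) - (d₂ + u₂)) * (x₁ - (d₁ + u₁)))
    lemma = solve-∀

  3*along-v : ∀ x₁ x₂ → + 3 * along-v x₁ x₂ ≡ det a (x₁ , x₂) c - det a b (x₁ , x₂)
  3*along-v x₁ x₂ = lemma d₁ d₂ u₁ u₂ v₁ v₂ x₁ x₂
    where
    lemma : ∀ d₁ d₂ u₁ u₂ v₁ v₂ x₁ x₂ →
      + 3 * (u₁ * (x₂ - d₂) - u₂ * (x₁ - d₁)) ≡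
      ((x₁ - (d₁ + u₁)) * ((d₂ - u₂ - v₂) - (d₂ + u₂)) - (x₂ - (d₂ + u₂)) * ((d₁ - u₁ - v₁) - (d₁ + u₁)))
      - (((d₁ + v₁) - (d₁ + u₁)) * (x₂ - (d₂ + u₂)) - ((d₂ + v₂) - (d₂ + u₂)) * (x₁ - (d₁ + u₁)))
    lemma = solve-∀

  lattice-points : ∀ x → InHull a b c x → Among a b c d x
  lattice-points (x₁ , x₂) h = among (compositions-of-3 (∣ E₁ ∣) (∣ E₂ ∣) (∣ E₃ ∣) p q
      (ℤP.+-injective (trans (cong₂ _+_ (cong₂ _+_ (abs E₁≥0) (abs E₂≥0)) (abs E₃≥0))
        (trans (sym (det-split a b c (x₁ , x₂))) det≡3)))
      (trans (3*along-u x₁ x₂) (sym (cong₂ _-_ (abs E₁≥0) (abs E₃≥0))))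
      (trans (3*along-v x₁ x₂) (sym (cong₂ _-_ (abs E₂≥0) (abs E₃≥0)))))
    where
    E₁ = det (x₁ , x₂) b c
    E₂ = det a (x₁ , x₂) c
    E₃ = det a b (x₁ , x₂)
    p = along-u x₁ x₂
    q = along-v x₁ x₂
    signs = inHull⇒det-nonneg a b c (x₁ , x₂) (subst (0ℤ ℤ.<_) (sym det≡3) (+<+ (s≤s z≤n))) h
    E₁≥0 = proj₁ signs
    E₂≥0 = proj₁ (proj₂ signs)
    E₃≥0 = proj₂ (proj₂ signs)
    abs : ∀ {E} → 0ℤ ℤ.≤ E → + ∣ E ∣ ≡ E
    abs = ℤP.0≤i⇒+∣i∣≡i

    at : ∀ {p′ q′ v} → p ≡ p′ → q ≡ q′ → point p′ q′ ≡ v → (x₁ , x₂) ≡ v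
    at p≡ q≡ e = trans (expansion x₁ x₂) (trans (cong₂ point p≡ q≡) e)

    among : (p ≡ 0ℤ × q ≡ 0ℤ) ⊎ (p ≡ 1ℤ × q ≡ 0ℤ) ⊎ (p ≡ 0ℤ × q ≡ 1ℤ) ⊎ (p ≡ -1ℤ × q ≡ -1ℤ) →
            Among a b c d (x₁ , x₂)
    among (inj₁ (p≡ , q≡)) = inj₂ (inj₂ (inj₂ (at p≡ q≡ point-d)))
    among (inj₂ (inj₁ (p≡ , q≡))) = inj₁ (at p≡ q≡ point-a)
    among (inj₂ (inj₂ (inj₁ (p≡ , q≡)))) = inj₂ (inj₁ (at p≡ q≡ point-b))
    among (inj₂ (inj₂ (inj₂ (p≡ , q≡)))) = inj₂ (inj₂ (inj₁ (at p≡ q≡ point-c)))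

unimodular⇒internal : ∀ d₁ d₂ u₁ u₂ v₁ v₂ → u₁ * v₂ - u₂ * v₁ ≡ 1ℤ →
  IsInternal (d₁ + u₁ , d₂ + u₂) (d₁ + v₁ , d₂ + v₂) (d₁ - u₁ - v₁ , d₂ - u₂ - v₂) (d₁ , d₂)
unimodular⇒internal d₁ d₂ u₁ u₂ v₁ v₂ unimodular =
  (λ det≡0 → 3≢0 (trans (sym det≡3) det≡0)) , interior , lattice-points
  where
  open UnimodularTriangle d₁ d₂ u₁ u₂ v₁ v₂ unimodular
  3≢0 : + 3 ≢ 0ℤ
  3≢0 ()

hull-of-inner-triangle : ∀ a₁ a₂ b₁ b₂ c₁ c₂ d₁ d₂ x₁ x₂ P Q R →
  let a = (a₁ , a₂) ; b = (b₁ , b₂) ; c = (c₁ , c₂) ; d = (d₁ , d₂) in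
  0ℤ ℤ.≤ det d b c → 0ℤ ℤ.≤ det a d c → 0ℤ ℤ.≤ det a b d → 0ℤ ℤ.< det a b c →
  0ℤ ℤ.≤ P → 0ℤ ℤ.≤ Q → 0ℤ ℤ.≤ R → 0ℤ ℤ.< P + Q + R →
  (P + Q + R) * x₁ ≡ P * d₁ + Q * a₁ + R * b₁ → (P + Q + R) * x₂ ≡ P * d₂ + Q * a₂ + R * b₂ →
  InHull a b c (x₁ , x₂)
hull-of-inner-triangle a₁ a₂ b₁ b₂ c₁ c₂ d₁ d₂ x₁ x₂ P Q R 0≤D₁ 0≤D₂ 0≤K 0<D 0≤P 0≤Q 0≤R 0<T e₁ e₂ =
  weights⇒inHull a₁ a₂ b₁ b₂ c₁ c₂ x₁ x₂
    (P * D₁ + D * Q) (P * D₂ + D * R) (P * K) (D * (P + Q + R))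
    (0≤i+j (0≤i*j 0≤P 0≤D₁) (0≤i*j (ℤP.<⇒≤ 0<D) 0≤Q))
    (0≤i+j (0≤i*j 0≤P 0≤D₂) (0≤i*j (ℤP.<⇒≤ 0<D) 0≤R))
    (0≤i*j 0≤P 0≤K) (0<i*j 0<D 0<T)
    (weights-sum (det-split (a₁ , a₂) (b₁ , b₂) (c₁ , c₂) (d₁ , d₂)))
    (regroup e₁ (proj₁ (cramer a₁ a₂ b₁ b₂ c₁ c₂ d₁ d₂)))
    (regroup e₂ (proj₂ (cramer a₁ a₂ b₁ b₂ c₁ c₂ d₁ d₂)))
  where
  D = det (a₁ , a₂) (b₁ , b₂) (c₁ , c₂)
  D₁ = det (d₁ , d₂) (b₁ , b₂) (c₁ , c₂)
  D₂ = det (a₁ , a₂) (d₁ , d₂) (c₁ , c₂)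
  K = det (a₁ , a₂) (b₁ , b₂) (d₁ , d₂)

  weights-sum : D ≡ D₁ + D₂ + K → (P * D₁ + D * Q) + (P * D₂ + D * R) + P * K ≡ D * (P + Q + R)
  weights-sum D≡ = trans (cong (λ Δ → (P * D₁ + Δ * Q) + (P * D₂ + Δ * R) + P * K) D≡)
    (trans (lemma P Q R D₁ D₂ K) (cong (λ Δ → Δ * (P + Q + R)) (sym D≡)))
    where
    lemma : ∀ P Q R D₁ D₂ K →
      (P * D₁ + (D₁ + D₂ + K) * Q) + (P * D₂ + (D₁ + D₂ + K) * R) + P * K ≡ (D₁ + D₂ + K) * (P + Q + R)
    lemma = solve-∀

  regroup : ∀ {x d a b c} → (P + Q + R) * x ≡ P * d + Q * a + R * b → D * d ≡ D₁ * a + D₂ * b + K * c →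
    (D * (P + Q + R)) * x ≡ (P * D₁ + D * Q) * a + (P * D₂ + D * R) * b + (P * K) * c
  regroup {x} {d} {a} {b} {c} hx hd = begin
    (D * (P + Q + R)) * x                      ≡⟨ ℤP.*-assoc D (P + Q + R) x ⟩
    D * ((P + Q + R) * x)                      ≡⟨ cong (D *_) hx ⟩
    D * (P * d + Q * a + R * b)                ≡⟨ expand D P Q R d a b ⟩
    P * (D * d) + (D * Q) * a + (D * R) * b    ≡⟨ cong (λ z → P * z + (D * Q) * a + (D * R) * b) hd ⟩
    P * (D₁ * a + D₂ * b + K * c) + (D * Q) * a + (D * R) * b
                                               ≡⟨ collect D D₁ D₂ K P Q R a b c ⟩
    (P * D₁ + D * Q) * a + (P * D₂ + D * R) * b + (P * K) * c ∎
    where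
    open ≡-Reasoning
    expand : ∀ D P Q R d a b → D * (P * d + Q * a + R * b) ≡ P * (D * d) + (D * Q) * a + (D * R) * b
    expand = solve-∀
    collect : ∀ D D₁ D₂ K P Q R a b c →
      P * (D₁ * a + D₂ * b + K * c) + (D * Q) * a + (D * R) * b ≡
      (P * D₁ + D * Q) * a + (P * D₂ + D * R) * b + (P * K) * c
    collect = solve-∀

module FourLatticePoints (a₁ a₂ b₁ b₂ c₁ c₂ d₁ d₂ : ℤ)
  (lattice-points : ∀ x → InHull (a₁ , a₂) (b₁ , b₂) (c₁ , c₂) x → Among (a₁ , a₂) (b₁ , b₂) (c₁ , c₂) (d₁ , d₂) x)
  (0<D₁ : 0ℤ ℤ.< det (d₁ , d₂) (b₁ , b₂) (c₁ , c₂))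
  (0<D₂ : 0ℤ ℤ.< det (a₁ , a₂) (d₁ , d₂) (c₁ , c₂))
  (0<K : 0ℤ ℤ.< det (a₁ , a₂) (b₁ , b₂) (d₁ , d₂)) where

  private
    a b c d : Point
    a = (a₁ , a₂)
    b = (b₁ , b₂)
    c = (c₁ , c₂)
    d = (d₁ , d₂)
    D₂ = det a d c
    K = det a b d
    u₁ = a₁ - d₁
    u₂ = a₂ - d₂
    v₁ = b₁ - d₁
    v₂ = b₂ - d₂

    0<D : 0ℤ ℤ.< det a b c
    0<D = subst (0ℤ ℤ.<_) (sym (det-split a b c d)) (ℤP.+-mono-< (ℤP.+-mono-< 0<D₁ 0<D₂) 0<K)

    inner-hull : ∀ x₁ x₂ P Q R → 0ℤ ℤ.≤ P → 0ℤ ℤ.≤ Q → 0ℤ ℤ.≤ R → 0ℤ ℤ.< P + Q + R →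
      (P + Q + R) * x₁ ≡ P * d₁ + Q * a₁ + R * b₁ → (P + Q + R) * x₂ ≡ P * d₂ + Q * a₂ + R * b₂ →
      Among a b c d (x₁ , x₂)
    inner-hull x₁ x₂ P Q R 0≤P 0≤Q 0≤R 0<T e₁ e₂ = lattice-points (x₁ , x₂)
      (hull-of-inner-triangle a₁ a₂ b₁ b₂ c₁ c₂ d₁ d₂ x₁ x₂ P Q R
        (ℤP.<⇒≤ 0<D₁) (ℤP.<⇒≤ 0<D₂) (ℤP.<⇒≤ 0<K) 0<D 0≤P 0≤Q 0≤R 0<T e₁ e₂)

    K≡u×v : K ≡ u₁ * v₂ - u₂ * v₁
    K≡u×v = lemma a₁ a₂ b₁ b₂ d₁ d₂
      where
      lemma : ∀ a₁ a₂ b₁ b₂ d₁ d₂ →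
        (b₁ - a₁) * (d₂ - a₂) - (b₂ - a₂) * (d₁ - a₁) ≡ (a₁ - d₁) * (b₂ - d₂) - (a₂ - d₂) * (b₁ - d₁)
      lemma = solve-∀

    u≢0 : u₁ ≡ 0ℤ → u₂ ≡ 0ℤ → ⊥
    u≢0 u₁≡0 u₂≡0 = ℤP.<-irrefl (sym (trans K≡u×v
      (trans (cong₂ (λ p q → p * v₂ - q * v₁) u₁≡0 u₂≡0) (zero-cross v₁ v₂)))) 0<K
      where
      zero-cross : ∀ v₁ v₂ → 0ℤ * v₂ - 0ℤ * v₁ ≡ 0ℤ
      zero-cross = solve-∀

    -- det d a x; it separates the four lattice points of the triangle.
    turn : Point → ℤ
    turn (x₁ , x₂) = u₁ * (x₂ - d₂) - u₂ * (x₁ - d₁)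

    turn-a : turn a ≡ 0ℤ
    turn-a = lemma a₁ a₂ d₁ d₂
      where
      lemma : ∀ a₁ a₂ d₁ d₂ → (a₁ - d₁) * (a₂ - d₂) - (a₂ - d₂) * (a₁ - d₁) ≡ 0ℤ
      lemma = solve-∀

    turn-c : turn c ≡ - D₂
    turn-c = lemma a₁ a₂ c₁ c₂ d₁ d₂
      where
      lemma : ∀ a₁ a₂ c₁ c₂ d₁ d₂ →
        (a₁ - d₁) * (c₂ - d₂) - (a₂ - d₂) * (c₁ - d₁) ≡ - ((d₁ - a₁) * (c₂ - a₂) - (d₂ - a₂) * (c₁ - a₁))
      lemma = solve-∀

    turn-d : turn d ≡ 0ℤ
    turn-d = lemma u₁ u₂ d₁ d₂
      where
      lemma : ∀ u₁ u₂ d₁ d₂ → u₁ * (d₂ - d₂) - u₂ * (d₁ - d₁) ≡ 0ℤ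
      lemma = solve-∀

    turn-among : ∀ x → Among a b c d x → (turn x ≡ 0ℤ) ⊎ (turn x ≡ K) ⊎ (turn x ≡ - D₂)
    turn-among x (inj₁ refl) = inj₁ turn-a
    turn-among x (inj₂ (inj₁ refl)) = inj₂ (inj₁ (sym K≡u×v))
    turn-among x (inj₂ (inj₂ (inj₁ refl))) = inj₂ (inj₂ turn-c)
    turn-among x (inj₂ (inj₂ (inj₂ refl))) = inj₁ turn-d

    shift : ∀ d y → d + y - d ≡ y
    shift = solve-∀

  -- If the edge d a is primitive and K ≥ 2, the point y with det(u, y) = 1 and
  -- 0 ≤ det(y, v) < K gives the lattice point d + y of conv{d, a, b} with turn 1.
  module Primitive (s t : ℤ) (bézout : s * u₁ + t * u₂ ≡ 1ℤ) (k : ℕ) (K≡ : K ≡ +[1+ suc k ]) where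
    private
      Kℕ = suc (suc k)
      e = - t * v₂ - s * v₁
      r = e ℤ.%ℕ Kℕ
      q = e ℤ./ℕ Kℕ
      y₁ = - q * u₁ - t
      y₂ = - q * u₂ + s

      u×y : u₁ * y₂ - u₂ * y₁ ≡ 1ℤ
      u×y = trans (lemma u₁ u₂ q s t) bézout
        where
        lemma : ∀ u₁ u₂ q s t → u₁ * (- q * u₂ + s) - u₂ * (- q * u₁ - t) ≡ s * u₁ + t * u₂
        lemma = solve-∀

      y×v : y₁ * v₂ - y₂ * v₁ ≡ + r
      y×v = begin
        y₁ * v₂ - y₂ * v₁                     ≡⟨ lemma u₁ u₂ v₁ v₂ q s t ⟩
        - q * (u₁ * v₂ - u₂ * v₁) + e         ≡⟨ cong₂ (λ κ ε → - q * κ + ε) (sym K≡u×v) e≡ ⟩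
        - q * K + (+ r + q * K)               ≡⟨ cancel q K (+ r) ⟩
        + r                                   ∎
        where
        open ≡-Reasoning
        e≡ : e ≡ + r + q * K
        e≡ = trans (ℤDM.a≡a%ℕn+[a/ℕn]*n e Kℕ) (cong (λ κ → + r + q * κ) (sym K≡))
        lemma : ∀ u₁ u₂ v₁ v₂ q s t →
          (- q * u₁ - t) * v₂ - (- q * u₂ + s) * v₁ ≡ - q * (u₁ * v₂ - u₂ * v₁) + (- t * v₂ - s * v₁)
        lemma = solve-∀
        cancel : ∀ q K r → - q * K + (r + q * K) ≡ r
        cancel = solve-∀

      -- K y = r u + v, so d + y = ((K - r - 1) d + r a + b) / K.
      weights : ∀ d a b y → K * y ≡ + r * (a - d) + 1ℤ * (b - d) →
                (K - + r - 1ℤ + + r + 1ℤ) * (d + y) ≡ (K - + r - 1ℤ) * d + + r * a + 1ℤ * b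
      weights d a b y Ky = trans (lemma K (+ r) d y)
        (trans (cong (λ z → K * d + z) Ky) (lemma′ K (+ r) d a b))
        where
        lemma : ∀ K r d y → (K - r - 1ℤ + r + 1ℤ) * (d + y) ≡ K * d + K * y
        lemma = solve-∀
        lemma′ : ∀ K r d a b → K * d + (r * (a - d) + 1ℤ * (b - d)) ≡ (K - r - 1ℤ) * d + r * a + 1ℤ * b
        lemma′ = solve-∀

      Ky₁ : K * y₁ ≡ + r * u₁ + 1ℤ * v₁
      Ky₁ = trans (cong (_* y₁) K≡u×v) (trans (proj₁ (cross-expansion u₁ u₂ v₁ v₂ y₁ y₂))
              (cong₂ (λ ρ ι → ρ * u₁ + ι * v₁) y×v u×y))
      Ky₂ : K * y₂ ≡ + r * u₂ + 1ℤ * v₂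
      Ky₂ = trans (cong (_* y₂) K≡u×v) (trans (proj₂ (cross-expansion u₁ u₂ v₁ v₂ y₁ y₂))
              (cong₂ (λ ρ ι → ρ * u₂ + ι * v₂) y×v u×y))

      0≤K-r-1 : 0ℤ ℤ.≤ K - + r - 1ℤ
      0≤K-r-1 = subst (λ κ → 0ℤ ℤ.≤ κ - + r - 1ℤ) (sym K≡) (lemma (ℕP.m≤n⇒∃[o]m+o≡n (ℤDM.n%ℕd<d e Kℕ)))
        where
        lemma : (∃ λ o → suc r ℕ.+ o ≡ Kℕ) → 0ℤ ℤ.≤ + Kℕ - + r - 1ℤ
        lemma (o , eq) = subst (λ n → 0ℤ ℤ.≤ + n - + r - 1ℤ) eq
          (subst (0ℤ ℤ.≤_) (sym (trans (cong (λ z → z - + r - 1ℤ) (ℤP.pos-+ (suc r) o)) (cancel (+ r) (+ o))))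
            (+≤+ z≤n))
          where
          cancel : ∀ r o → (1ℤ + r) + o - r - 1ℤ ≡ o
          cancel = solve-∀

      point-among : Among a b c d (d₁ + y₁ , d₂ + y₂)
      point-among = inner-hull (d₁ + y₁) (d₂ + y₂) (K - + r - 1ℤ) (+ r) 1ℤ 0≤K-r-1 (+≤+ z≤n) (+≤+ z≤n)
        (subst (0ℤ ℤ.<_) (sym (sum K (+ r))) 0<K) (weights d₁ a₁ b₁ y₁ Ky₁) (weights d₂ a₂ b₂ y₂ Ky₂)
        where
        sum : ∀ K r → K - r - 1ℤ + r + 1ℤ ≡ K
        sum = solve-∀

      turn≡1 : turn (d₁ + y₁ , d₂ + y₂) ≡ 1ℤ
      turn≡1 = trans (cong₂ (λ p q → u₁ * p - u₂ * q) (shift d₂ y₂) (shift d₁ y₁)) u×y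

    impossible : ⊥
    impossible = excluded (turn-among (d₁ + y₁ , d₂ + y₂) point-among)
      where
      excluded : let t = turn (d₁ + y₁ , d₂ + y₂) in (t ≡ 0ℤ) ⊎ (t ≡ K) ⊎ (t ≡ - D₂) → ⊥
      excluded (inj₁ turn≡0) with () ← trans (sym turn≡1) turn≡0
      excluded (inj₂ (inj₁ turn≡K)) with () ← trans (sym turn≡1) (trans turn≡K K≡)
      excluded (inj₂ (inj₂ turn≡-D₂)) = -pos≢1 D₂ 0<D₂ (trans (sym turn≡-D₂) turn≡1)
        where
        -pos≢1 : ∀ D → 0ℤ ℤ.< D → - D ≢ 1ℤ
        -pos≢1 +[1+ _ ] _ ()

  -- If a - d = g w with g ≥ 2, the lattice point d + w of the edge d a is a fifth one.
  module NonPrimitive (g : ℕ) (w₁ w₂ : ℤ)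
    (u₁≡ : u₁ ≡ w₁ * + suc (suc g)) (u₂≡ : u₂ ≡ w₂ * + suc (suc g)) where
    private
      G = + suc (suc g)

      weights : ∀ d a b w → a - d ≡ w * G → (G - 1ℤ + 1ℤ + 0ℤ) * (d + w) ≡ (G - 1ℤ) * d + 1ℤ * a + 0ℤ * b
      weights d a b w a-d≡ = trans (lemma G d w) (trans (cong (λ z → G * d + z) (sym a-d≡)) (lemma′ G d a b))
        where
        lemma : ∀ G d w → (G - 1ℤ + 1ℤ + 0ℤ) * (d + w) ≡ G * d + w * G
        lemma = solve-∀
        lemma′ : ∀ G d a b → G * d + (a - d) ≡ (G - 1ℤ) * d + 1ℤ * a + 0ℤ * b
        lemma′ = solve-∀

      point-among : Among a b c d (d₁ + w₁ , d₂ + w₂)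
      point-among = inner-hull (d₁ + w₁) (d₂ + w₂) (G - 1ℤ) 1ℤ 0ℤ (+≤+ z≤n) (+≤+ z≤n) (+≤+ z≤n) (+<+ (s≤s z≤n))
        (weights d₁ a₁ b₁ w₁ u₁≡) (weights d₂ a₂ b₂ w₂ u₂≡)

      turn≡0 : turn (d₁ + w₁ , d₂ + w₂) ≡ 0ℤ
      turn≡0 = trans (cong₂ (λ p q → u₁ * p - u₂ * q) (shift d₂ w₂) (shift d₁ w₁))
        (trans (cong₂ (λ p q → p * w₂ - q * w₁) u₁≡ u₂≡) (lemma w₁ w₂ G))
        where
        lemma : ∀ w₁ w₂ G → (w₁ * G) * w₂ - (w₂ * G) * w₁ ≡ 0ℤ
        lemma = solve-∀

      fixed⇒0 : ∀ w → w ≡ w * G → w ≡ 0ℤ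
      fixed⇒0 w w≡ with ℤP.i*j≡0⇒i≡0∨j≡0 w {+ suc g}
                          (trans (sym (lemma w G)) (trans (cong (_- w) (sym w≡)) (ℤP.+-inverseʳ w)))
        where
        lemma : ∀ w G → w * G - w ≡ w * (G - 1ℤ)
        lemma = solve-∀
      ... | inj₁ w≡0 = w≡0

      not-a : (d₁ + w₁ , d₂ + w₂) ≢ a
      not-a refl = u≢0 (trans u₁≡ (cong (_* G) (fixed⇒0 w₁ (trans (sym (shift d₁ w₁)) u₁≡))))
                       (trans u₂≡ (cong (_* G) (fixed⇒0 w₂ (trans (sym (shift d₂ w₂)) u₂≡))))

      not-d : (d₁ + w₁ , d₂ + w₂) ≢ d
      not-d e = u≢0 (trans u₁≡ (cong (_* G) (vanish d₁ w₁ (cong proj₁ e))))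
                    (trans u₂≡ (cong (_* G) (vanish d₂ w₂ (cong proj₂ e))))
        where
        vanish : ∀ d w → d + w ≡ d → w ≡ 0ℤ
        vanish d w e = trans (sym (shift d w)) (trans (cong (_- d) e) (ℤP.+-inverseʳ d))

    impossible : ⊥
    impossible = excluded point-among
      where
      excluded : Among a b c d (d₁ + w₁ , d₂ + w₂) → ⊥
      excluded (inj₁ x≡a) = not-a x≡a
      excluded (inj₂ (inj₁ x≡b)) = ℤP.<-irrefl (trans (sym turn≡0) (trans (cong turn x≡b) (sym K≡u×v))) 0<K
      excluded (inj₂ (inj₂ (inj₁ x≡c))) = ℤP.<-irrefl (sym (trans (sym (ℤP.neg-involutive D₂))
        (cong -_ (trans (sym turn-c) (trans (cong turn (sym x≡c)) turn≡0))))) 0<D₂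
      excluded (inj₂ (inj₂ (inj₂ x≡d))) = not-d x≡d

  det≡1 : det a b d ≡ 1ℤ
  det≡1 = by-size K 0<K refl
    where
    by-gcd : ∀ k → K ≡ +[1+ suc k ] → BézoutGcd u₁ u₂ → ⊥
    by-gcd k K≡ record { gcd = 0 ; gcd∣a = divides q₁ u₁≡ ; gcd∣b = divides q₂ u₂≡ } =
      u≢0 (trans u₁≡ (ℤP.*-zeroʳ q₁)) (trans u₂≡ (ℤP.*-zeroʳ q₂))
    by-gcd k K≡ record { gcd = 1 ; s = s ; t = t ; identity = identity } =
      Primitive.impossible s t identity k K≡
    by-gcd k K≡ record { gcd = suc (suc g) ; gcd∣a = divides w₁ u₁≡ ; gcd∣b = divides w₂ u₂≡ } =
      NonPrimitive.impossible g w₁ w₂ u₁≡ u₂≡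
    by-size : ∀ κ → 0ℤ ℤ.< κ → K ≡ κ → K ≡ 1ℤ
    by-size +[1+ zero ] _ K≡ = K≡
    by-size +[1+ suc k ] _ K≡ = ⊥-elim (by-gcd k K≡ (bézoutGcd u₁ u₂))
    by-size (+ zero) (+<+ ()) _

Centroid : Point → Point → Point → Point → Set
Centroid (a₁ , a₂) (b₁ , b₂) (c₁ , c₂) (d₁ , d₂) = (+ 3 * d₁ ≡ a₁ + b₁ + c₁) × (+ 3 * d₂ ≡ a₂ + b₂ + c₂)

rotate-hull : ∀ p q r x → InHull p q r x → InHull r p q x
rotate-hull (p₁ , p₂) (q₁ , q₂) (r₁ , r₂) (x₁ , x₂) (l , m , n , 0≤l , 0≤m , 0≤n , s , e₁ , e₂) =
  n , l , m , 0≤n , 0≤l , 0≤m , trans (sym (rotate l m n)) s ,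
  trans e₁ (rotate (l ℚ.* ι p₁) (m ℚ.* ι q₁) (n ℚ.* ι r₁)) ,
  trans e₂ (rotate (l ℚ.* ι p₂) (m ℚ.* ι q₂) (n ℚ.* ι r₂))
  where
  rotate : ∀ X Y Z → X ℚ.+ Y ℚ.+ Z ≡ Z ℚ.+ X ℚ.+ Y
  rotate X Y Z = trans (ℚP.+-comm (X ℚ.+ Y) Z) (sym (ℚP.+-assoc Z X Y))

rotate-among : ∀ {a b c d x} → Among a b c d x → Among b c a d x
rotate-among (inj₁ e) = inj₂ (inj₂ (inj₁ e))
rotate-among (inj₂ (inj₁ e)) = inj₁ e
rotate-among (inj₂ (inj₂ (inj₁ e))) = inj₂ (inj₁ e)
rotate-among (inj₂ (inj₂ (inj₂ e))) = inj₂ (inj₂ (inj₂ e))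

positive-internal : ∀ a b c d → IsInternal a b c d → 0ℤ ℤ.< det a b c → Centroid a b c d × det d a b ≡ 1ℤ
positive-internal a@(a₁ , a₂) b@(b₁ , b₂) c@(c₁ , c₂) d@(d₁ , d₂) (_ , interior , lattice-points) 0<D =
  (three-d (proj₁ (cramer a₁ a₂ b₁ b₂ c₁ c₂ d₁ d₂)) , three-d (proj₂ (cramer a₁ a₂ b₁ b₂ c₁ c₂ d₁ d₂))) ,
  trans (det-cyclic d a b) K≡1
  where
  signs = inInterior⇒det-pos a b c d 0<D interior
  0<D₁ = proj₁ signs
  0<D₂ = proj₁ (proj₂ signs)
  0<K = proj₂ (proj₂ signs)

  K≡1 : det a b d ≡ 1ℤ
  K≡1 = FourLatticePoints.det≡1 a₁ a₂ b₁ b₂ c₁ c₂ d₁ d₂ lattice-points 0<D₁ 0<D₂ 0<K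

  D₁≡1 : det d b c ≡ 1ℤ
  D₁≡1 = trans (det-cyclic d b c) (FourLatticePoints.det≡1 b₁ b₂ c₁ c₂ a₁ a₂ d₁ d₂
    (λ x h → rotate-among (lattice-points x (rotate-hull b c a x h)))
    (subst (0ℤ ℤ.<_) (det-cyclic a d c) 0<D₂) (subst (0ℤ ℤ.<_) (det-cyclic a b d) 0<K)
    (subst (0ℤ ℤ.<_) (det-cyclic d b c) 0<D₁))

  D₂≡1 : det a d c ≡ 1ℤ
  D₂≡1 = trans (det-cyclic a d c) (trans (det-cyclic d c a) (FourLatticePoints.det≡1 c₁ c₂ a₁ a₂ b₁ b₂ d₁ d₂
    (λ x h → rotate-among (rotate-among (lattice-points x (rotate-hull b c a x (rotate-hull c a b x h)))))
    (subst (0ℤ ℤ.<_) (trans (det-cyclic a b d) (det-cyclic b d a)) 0<K)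
    (subst (0ℤ ℤ.<_) (trans (det-cyclic d b c) (det-cyclic b c d)) 0<D₁)
    (subst (0ℤ ℤ.<_) (trans (det-cyclic a d c) (det-cyclic d c a)) 0<D₂)))

  D≡3 : det a b c ≡ + 3
  D≡3 = trans (det-split a b c d) (cong₂ _+_ (cong₂ _+_ D₁≡1 D₂≡1) K≡1)

  three-d : ∀ {x p q r} → det a b c * x ≡ det d b c * p + det a d c * q + det a b d * r → + 3 * x ≡ p + q + r
  three-d {x} {p} {q} {r} e = trans (cong (_* x) (sym D≡3)) (trans e
    (trans (cong₂ _+_ (cong₂ _+_ (cong (_* p) D₁≡1) (cong (_* q) D₂≡1)) (cong (_* r) K≡1)) (unit p q r)))
    where
    unit : ∀ p q r → 1ℤ * p + 1ℤ * q + 1ℤ * r ≡ p + q + r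
    unit = solve-∀

swap : Point → Point
swap (x , y) = (y , x)

det-swap : ∀ p q r → det (swap p) (swap q) (swap r) ≡ - det p q r
det-swap (p₁ , p₂) (q₁ , q₂) (r₁ , r₂) = lemma p₁ p₂ q₁ q₂ r₁ r₂
  where
  lemma : ∀ p₁ p₂ q₁ q₂ r₁ r₂ →
    (q₂ - p₂) * (r₁ - p₁) - (q₁ - p₁) * (r₂ - p₂) ≡ - ((q₁ - p₁) * (r₂ - p₂) - (q₂ - p₂) * (r₁ - p₁))
  lemma = solve-∀

swap-internal : ∀ a b c d → IsInternal a b c d → IsInternal (swap a) (swap b) (swap c) (swap d)
swap-internal a@(_ , _) b@(_ , _) c@(_ , _) d@(_ , _)
  (non-collinear , (l , m , n , 0<l , 0<m , 0<n , s , e₁ , e₂) , lattice-points) =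
  (λ det≡0 → non-collinear (trans (sym (ℤP.neg-involutive _)) (cong -_ (trans (sym (det-swap a b c)) det≡0)))) ,
  (l , m , n , 0<l , 0<m , 0<n , s , e₂ , e₁) ,
  λ { (x₁ , x₂) (l , m , n , 0≤l , 0≤m , 0≤n , s , e₁ , e₂) →
        swap-among (lattice-points (x₂ , x₁) (l , m , n , 0≤l , 0≤m , 0≤n , s , e₂ , e₁)) }
  where
  swap-among : ∀ {x} → Among a b c d x → Among (swap a) (swap b) (swap c) (swap d) (swap x)
  swap-among (inj₁ e) = inj₁ (cong swap e)
  swap-among (inj₂ (inj₁ e)) = inj₂ (inj₁ (cong swap e))
  swap-among (inj₂ (inj₂ (inj₁ e))) = inj₂ (inj₂ (inj₁ (cong swap e)))
  swap-among (inj₂ (inj₂ (inj₂ e))) = inj₂ (inj₂ (inj₂ (cong swap e)))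

internal⇒centroid×unimodular : ∀ a b c d → IsInternal a b c d →
  Centroid a b c d × ((det d a b ≡ 1ℤ) ⊎ (det d a b ≡ -1ℤ))
internal⇒centroid×unimodular a@(_ , _) b@(_ , _) c@(_ , _) d@(_ , _) internal
  with ℤP.<-cmp 0ℤ (det a b c)
... | tri< 0<D _ _ = map₂ inj₁ (positive-internal a b c d internal 0<D)
... | tri≈ _ 0≡D _ = ⊥-elim (proj₁ internal (sym 0≡D))
... | tri> _ _ D<0 =
  map ×-swap (λ e → inj₂ (trans (sym (ℤP.neg-involutive _)) (cong -_ (trans (sym (det-swap d a b)) e))))
  (positive-internal (swap a) (swap b) (swap c) (swap d) (swap-internal a b c d internal)
    (subst (0ℤ ℤ.<_) (sym (det-swap a b c)) (ℤP.neg-mono-< D<0)))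

-- Stability of I m

module _ {M a₂ b₂ c₂ d₂ : ℤ} (centroid : + 3 * d₂ ≡ a₂ + b₂ + c₂) where

  private
    M∣sum : M ∣ d₂ → M ∣ a₂ + b₂ + c₂
    M∣sum M∣d₂ = subst (M ∣_) centroid (∣n⇒∣m*n (+ 3) M∣d₂)

  ∣-first-vertex : M ∣ d₂ → M ∣ b₂ → M ∣ c₂ → M ∣ a₂
  ∣-first-vertex M∣d₂ M∣b₂ M∣c₂ = ∣m+n∣n⇒∣m (∣m+n∣n⇒∣m (M∣sum M∣d₂) M∣c₂) M∣b₂

  ∣-second-vertex : M ∣ d₂ → M ∣ a₂ → M ∣ c₂ → M ∣ b₂
  ∣-second-vertex M∣d₂ M∣a₂ M∣c₂ = ∣m+n∣m⇒∣n (∣m+n∣n⇒∣m (M∣sum M∣d₂) M∣c₂) M∣a₂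

  ∣-third-vertex : M ∣ d₂ → M ∣ a₂ → M ∣ b₂ → M ∣ c₂
  ∣-third-vertex M∣d₂ M∣a₂ M∣b₂ = ∣m+n∣m⇒∣n (M∣sum M∣d₂) (∣m∣n⇒∣m+n M∣a₂ M∣b₂)

  -- 3 det(d, a, b) = (a₁ - d₁)(3b₂ - 3d₂) - (3a₂ - 3d₂)(b₁ - d₁), and 3d₂ = a₂ + b₂ + c₂.
  ∣-centre : ∀ a₁ b₁ d₁ → M ∣ a₂ → M ∣ b₂ → M ∣ c₂ → M ∣ + 3 * det (d₁ , d₂) (a₁ , a₂) (b₁ , b₂)
  ∣-centre a₁ b₁ d₁ M∣a₂ M∣b₂ M∣c₂ = subst (M ∣_) (sym three-det)
    (∣m∣n⇒∣m-n (∣n⇒∣m*n (a₁ - d₁) (∣m∣n⇒∣m-n (∣m∣n⇒∣m-n (∣n⇒∣m*n (+ 2) M∣b₂) M∣a₂) M∣c₂))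
               (∣m⇒∣m*n (b₁ - d₁) (∣m∣n⇒∣m-n (∣m∣n⇒∣m-n (∣n⇒∣m*n (+ 2) M∣a₂) M∣b₂) M∣c₂)))
    where
    three-det : + 3 * det (d₁ , d₂) (a₁ , a₂) (b₁ , b₂) ≡
      (a₁ - d₁) * (+ 2 * b₂ - a₂ - c₂) - (+ 2 * a₂ - b₂ - c₂) * (b₁ - d₁)
    three-det = trans (lemma a₁ a₂ b₁ b₂ d₁ d₂)
      (trans (cong (λ s → (a₁ - d₁) * (+ 3 * b₂ - s) - (+ 3 * a₂ - s) * (b₁ - d₁)) centroid)
        (lemma′ a₁ a₂ b₁ b₂ c₂ d₁))
      where
      lemma : ∀ a₁ a₂ b₁ b₂ d₁ d₂ → + 3 * ((a₁ - d₁) * (b₂ - d₂) - (a₂ - d₂) * (b₁ - d₁)) ≡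
        (a₁ - d₁) * (+ 3 * b₂ - + 3 * d₂) - (+ 3 * a₂ - + 3 * d₂) * (b₁ - d₁)
      lemma = solve-∀
      lemma′ : ∀ a₁ a₂ b₁ b₂ c₂ d₁ → (a₁ - d₁) * (+ 3 * b₂ - (a₂ + b₂ + c₂)) - (+ 3 * a₂ - (a₂ + b₂ + c₂)) * (b₁ - d₁)
        ≡ (a₁ - d₁) * (+ 2 * b₂ - a₂ - c₂) - (+ 2 * a₂ - b₂ - c₂) * (b₁ - d₁)
      lemma′ = solve-∀

divisor-of-3 : ∀ {m} → m ℕD.∣ 3 → m ≡ 1 ⊎ m ≡ 3
divisor-of-3 = prime⇒irreducible (from-yes (prime? 3))

∈I⇒∣ : ∀ {m} x y → (x , y) ∈ I m → + m ∣ y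
∈I⇒∣ x y = ∣ᵤ⇒∣

∣⇒∈I : ∀ {m} x y → + m ∣ y → (x , y) ∈ I m
∣⇒∈I x y = ∣⇒∣ᵤ

I-stable : ∀ m → m ≢ 3 → IStable (I m)
I-stable m m≢3 (a₁ , a₂) (b₁ , b₂) (c₁ , c₂) (d₁ , d₂) internal =
  excluded (internal⇒centroid×unimodular _ _ _ _ internal)
  where
  excluded : Centroid (a₁ , a₂) (b₁ , b₂) (c₁ , c₂) (d₁ , d₂) ×
             ((det (d₁ , d₂) (a₁ , a₂) (b₁ , b₂) ≡ 1ℤ) ⊎ (det (d₁ , d₂) (a₁ , a₂) (b₁ , b₂) ≡ -1ℤ)) →
             ¬ ExactlyThreeIn (I m) (a₁ , a₂) (b₁ , b₂) (c₁ , c₂) (d₁ , d₂)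
  excluded ((_ , centroid) , _) (inj₁ (a∉ , b∈ , c∈ , d∈)) =
    a∉ (∣⇒∈I a₁ a₂ (∣-first-vertex centroid (∈I⇒∣ d₁ d₂ d∈) (∈I⇒∣ b₁ b₂ b∈) (∈I⇒∣ c₁ c₂ c∈)))
  excluded ((_ , centroid) , _) (inj₂ (inj₁ (a∈ , b∉ , c∈ , d∈))) =
    b∉ (∣⇒∈I b₁ b₂ (∣-second-vertex centroid (∈I⇒∣ d₁ d₂ d∈) (∈I⇒∣ a₁ a₂ a∈) (∈I⇒∣ c₁ c₂ c∈)))
  excluded ((_ , centroid) , _) (inj₂ (inj₂ (inj₁ (a∈ , b∈ , c∉ , d∈)))) =
    c∉ (∣⇒∈I c₁ c₂ (∣-third-vertex centroid (∈I⇒∣ d₁ d₂ d∈) (∈I⇒∣ a₁ a₂ a∈) (∈I⇒∣ b₁ b₂ b∈)))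
  excluded ((_ , centroid) , unimodular) (inj₂ (inj₂ (inj₂ (a∈ , b∈ , c∈ , d∉)))) =
    small-divisor (divisor-of-3 (m∣3 unimodular))
    where
    m∣3det : + m ∣ + 3 * det (d₁ , d₂) (a₁ , a₂) (b₁ , b₂)
    m∣3det = ∣-centre centroid a₁ b₁ d₁ (∈I⇒∣ a₁ a₂ a∈) (∈I⇒∣ b₁ b₂ b∈) (∈I⇒∣ c₁ c₂ c∈)
    m∣3 : (det (d₁ , d₂) (a₁ , a₂) (b₁ , b₂) ≡ 1ℤ) ⊎ (det (d₁ , d₂) (a₁ , a₂) (b₁ , b₂) ≡ -1ℤ) → m ℕD.∣ 3
    m∣3 (inj₁ ε≡1) = ∣⇒∣ᵤ (subst (λ ε → + m ∣ + 3 * ε) ε≡1 m∣3det)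
    m∣3 (inj₂ ε≡-1) = ∣⇒∣ᵤ (subst (λ ε → + m ∣ + 3 * ε) ε≡-1 m∣3det)
    small-divisor : m ≡ 1 ⊎ m ≡ 3 → ⊥
    small-divisor (inj₁ refl) = d∉ (ℕD.1∣ _)
    small-divisor (inj₂ m≡3) = m≢3 m≡3

I3-unstable : ¬ IStable (I 3)
I3-unstable stable = stable _ _ _ _ (unimodular⇒internal (+ 0) (+ 1) (+ 0) -1ℤ (+ 1) -1ℤ refl)
  (inj₂ (inj₂ (inj₂ (ℕD.divides 0 refl , ℕD.divides 0 refl , ℕD.divides 1 refl , 3∤1))))
  where
  3∤1 : ¬ (3 ℕD.∣ 1)
  3∤1 (ℕD.divides (suc q) ())

I-antitone : ∀ {m n} → m ℕD.∣ n → I n ⊆ I m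
I-antitone m∣n {_ , _} n∣y = ℕD.∣-trans m∣n n∣y

I-proper : ∀ {m} → 1 < m → ProperSubset (I m)
I-proper 1<m = (0ℤ , 1ℤ) , λ m∣1 → ℕP.<⇒≱ 1<m (ℕD.∣⇒≤ m∣1)

record ProperDivisor≢3 (n : ℕ) : Set where
  field
    m : ℕ
    m∣n : m ℕD.∣ n
    1<m : 1 < m
    m<n : m < n
    m≢3 : m ≢ 3

proper-divisor⇒not-maximal : ∀ {n} → ProperDivisor≢3 n → ¬ MaximalIStable (I n)
proper-divisor⇒not-maximal {n} divisor (_ , _ , maximal) =
  maximal (I m , I-stable m m≢3 , I-proper 1<m , (λ {x} → I-antitone m∣n {x}) , (0ℤ , + m) , ℕD.∣-refl , m∉I)
  where
  open ProperDivisor≢3 divisor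
  m∉I : ¬ (n ℕD.∣ m)
  m∉I n∣m = ℕP.<⇒≱ m<n (ℕD.∣⇒≤ {{ℕ.>-nonZero (ℕP.<-trans (s≤s z≤n) 1<m)}} n∣m)

composite⇒proper-divisor : ∀ n → 1 < n → ¬ Prime n → n ≢ 9 → ProperDivisor≢3 n
composite⇒proper-divisor 1 (s≤s ()) _ _
composite⇒proper-divisor n@(suc (suc _)) _ ¬prime n≢9 with ¬prime⇒composite ¬prime
... | hasNonTrivialDivisor {d} {{nontrivial}} d<n d∣n with d ℕ.≟ 3
...   | no d≢3 = record { m = d ; m∣n = d∣n ; 1<m = ℕ.nonTrivial⇒n>1 d {{nontrivial}} ; m<n = d<n ; m≢3 = d≢3 }
...   | yes refl = cofactor d∣n
  where
  -- The divisor found is 3; its cofactor n / 3 is not 3 since n ≢ 9.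
  cofactor : 3 ℕD.∣ n → ProperDivisor≢3 n
  cofactor (ℕD.divides q n≡q*3) = record
    { m = q ; m∣n = ℕD.divides 3 (trans n≡q*3 (ℕP.*-comm q 3)) ; 1<m = 1<q q n≡q*3 ; m<n = q<n
    ; m≢3 = λ q≡3 → n≢9 (trans n≡q*3 (cong (ℕ._* 3) q≡3)) }
    where
    1<q : ∀ q → n ≡ q ℕ.* 3 → 1 < q
    1<q zero ()
    1<q 1 refl = ⊥-elim (ℕP.<-irrefl refl d<n)
    1<q (suc (suc q)) _ = s≤s (s≤s z≤n)
    q<n : q < n
    q<n = subst (q <_) (sym n≡q*3)
      (ℕP.m<m*n q 3 {{ℕ.>-nonZero (ℕP.<-trans (s≤s z≤n) (1<q q n≡q*3))}} (s≤s (s≤s z≤n)))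

maximal⇒9-or-prime : ∀ n → 1 ≤ n → MaximalIStable (I n) → n ≡ 9 ⊎ (Prime n × n ≢ 3)
maximal⇒9-or-prime 1 _ (_ , (_ , p∉I1) , _) = ⊥-elim (p∉I1 (ℕD.1∣ _))
maximal⇒9-or-prime n@(suc (suc _)) _ maximal@(stable , _) with n ℕ.≟ 9 | prime? n
... | yes n≡9 | _ = inj₁ n≡9
... | no _ | yes prime-n = inj₂ (prime-n , λ n≡3 → I3-unstable (subst (λ k → IStable (I k)) n≡3 stable))
... | no n≢9 | no ¬prime =
  ⊥-elim (proper-divisor⇒not-maximal (composite⇒proper-divisor n (s≤s (s≤s z≤n)) ¬prime n≢9) maximal)

-- Bézout pairs and row propagation

BézoutPair : ℤ → ℤ → Set
BézoutPair a b = ∃ λ s → ∃ λ t → s * a + t * b ≡ 1ℤ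

bézout-sym : ∀ {a b} → BézoutPair a b → BézoutPair b a
bézout-sym {a} {b} (s , t , e) = t , s , trans (ℤP.+-comm (t * b) (s * a)) e

bézout-neg : ∀ {a b} → BézoutPair a b → BézoutPair a (- b)
bézout-neg {a} {b} (s , t , e) = s , - t , trans (lemma s a t b) e
  where
  lemma : ∀ s a t b → s * a + - t * - b ≡ s * a + t * b
  lemma = solve-∀

bézout-shift : ∀ {a b} k → BézoutPair a b → BézoutPair (a + k * b) b
bézout-shift {a} {b} k (s , t , e) = s , t - s * k , trans (lemma s a t b k) e
  where
  lemma : ∀ s a t b k → s * (a + k * b) + (t - s * k) * b ≡ s * a + t * b
  lemma = solve-∀

bézout-mirror : ∀ {r q} → BézoutPair r q → BézoutPair (- r - q) (- q)
bézout-mirror {r} {q} (s , t , e) = - s , s - t , trans (lemma s r t q) e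
  where
  lemma : ∀ s r t q → - s * (- r - q) + (s - t) * - q ≡ s * r + t * q
  lemma = solve-∀

bézout-factor : ∀ {a} k {b} → BézoutPair a (k * b) → BézoutPair a b
bézout-factor {a} k {b} (s , t , e) = s , t * k , trans (cong (λ w → s * a + w) (ℤP.*-assoc t k b)) e

bézout-* : ∀ {a b c} → BézoutPair a b → BézoutPair a c → BézoutPair a (b * c)
bézout-* {a} {b} {c} (s , t , e) (s′ , t′ , e′) = s * s′ * a + s * t′ * c + t * s′ * b , t * t′ ,
  trans (lemma s t s′ t′ a b c) (trans (cong₂ _*_ e e′) refl)
  where
  lemma : ∀ s t s′ t′ a b c →
    (s * s′ * a + s * t′ * c + t * s′ * b) * a + t * t′ * (b * c) ≡ (s * a + t * b) * (s′ * a + t′ * c)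
  lemma = solve-∀

bézout-odd : ∀ s → BézoutPair (+ 2 * s + 1ℤ) (+ 2)
bézout-odd s = 1ℤ , - s , lemma s
  where
  lemma : ∀ s → 1ℤ * (+ 2 * s + 1ℤ) + - s * + 2 ≡ 1ℤ
  lemma = solve-∀

ℤ-induction : (P : ℤ → Set) → P 0ℤ → (∀ i → P i → P (1ℤ + i)) → (∀ i → P i → P (-1ℤ + i)) → ∀ i → P i
ℤ-induction P p₀ up down (+ zero) = p₀
ℤ-induction P p₀ up down (+ suc n) = up (+ n) (ℤ-induction P p₀ up down (+ n))
ℤ-induction P p₀ up down -[1+ zero ] = down 0ℤ p₀
ℤ-induction P p₀ up down -[1+ suc n ] = down -[1+ n ] (ℤ-induction P p₀ up down -[1+ n ])

module _ (P : ℤ → Set) where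

  translate-multiples : ∀ g → (∀ z → P z → P (z + g)) → (∀ z → P z → P (z - g)) → ∀ k z → P z → P (z + k * g)
  translate-multiples g up down k z p = ℤ-induction (λ k → P (z + k * g))
    (subst P (zero-step z g) p)
    (λ k q → subst P (up-step z k g) (up _ q))
    (λ k q → subst P (down-step z k g) (down _ q)) k
    where
    zero-step : ∀ z g → z ≡ z + 0ℤ * g
    zero-step = solve-∀
    up-step : ∀ z k g → z + k * g + g ≡ z + (1ℤ + k) * g
    up-step = solve-∀
    down-step : ∀ z k g → z + k * g - g ≡ z + (-1ℤ + k) * g
    down-step = solve-∀

  coprime-translations : ∀ g h → BézoutPair g h →
    (∀ z → P z → P (z + g)) → (∀ z → P z → P (z - g)) →
    (∀ z → P z → P (z + h)) → (∀ z → P z → P (z - h)) →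
    ∀ z x → P z → P x
  coprime-translations g h (s , t , e) g⁺ g⁻ h⁺ h⁻ z x p =
    subst P (trans (regroup z x s t g h) (trans (cong (λ w → z + (x - z) * w) e) (cancel z x)))
      (translate-multiples h h⁺ h⁻ ((x - z) * t) _ (translate-multiples g g⁺ g⁻ ((x - z) * s) z p))
    where
    regroup : ∀ z x s t g h → z + ((x - z) * s) * g + ((x - z) * t) * h ≡ z + (x - z) * (s * g + t * h)
    regroup = solve-∀
    cancel : ∀ z x → z + (x - z) * 1ℤ ≡ x
    cancel = solve-∀

-- Shifting a row by ±2N only uses the rows 0 and ±N, which is why y is taken coprime to 2N.
module RowPropagation (R : ℤ → Set)
  (rule : ∀ X p q → BézoutPair p q → R X → R (X + p) → R (X + q) → R (X - p - q))
  (N : ℤ) (multiples : ∀ k → R (k * N))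
  (y : ℤ) (coprime : BézoutPair y (+ 2 * N)) (R-y : R y) where

  private
    M = + 2 * N

    multiple : ∀ {w} k → k * N ≡ w → R w
    multiple k e = subst R e (multiples k)

    mirror : ∀ r q → BézoutPair r q → R q → R r → R (- r - q)
    mirror r q bz R-q R-r = subst R (lemma r q)
      (rule 0ℤ r q bz (multiple 0ℤ refl) (subst R (sym (ℤP.+-identityˡ r)) R-r) (subst R (sym (ℤP.+-identityˡ q)) R-q))
      where
      lemma : ∀ r q → 0ℤ - r - q ≡ - r - q
      lemma = solve-∀

    double-mirror : ∀ r q → BézoutPair r q → R q → R (- q) → R r → R (r + + 2 * q)
    double-mirror r q bz R-q R--q R-r =
      subst R (lemma r q) (mirror (- r - q) (- q) (bézout-mirror bz) R--q (mirror r q bz R-q R-r))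
      where
      lemma : ∀ r q → - (- r - q) - - q ≡ r + + 2 * q
      lemma = solve-∀

    first-level : ∀ j → R (y + j * M)
    first-level = ℤ-induction (λ j → R (y + j * M)) (subst R (lemma₀ y M) R-y)
      (λ j R-j → subst R (up y j N) (double-mirror _ N (coprime-j j) (multiple 1ℤ (ℤP.*-identityˡ N))
                                  (multiple -1ℤ (ℤP.-1*i≡-i N)) R-j))
      (λ j R-j → subst R (down y j N) (double-mirror _ (- N) (bézout-neg (coprime-j j)) (multiple -1ℤ (ℤP.-1*i≡-i N))
                                    (multiple 1ℤ (trans (ℤP.*-identityˡ N) (sym (ℤP.neg-involutive N)))) R-j))
      where
      coprime-j : ∀ j → BézoutPair (y + j * M) N
      coprime-j j = subst (λ w → BézoutPair w N) (lemma j) (bézout-shift (j * + 2) (bézout-factor (+ 2) coprime))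
        where
        lemma : ∀ j → y + j * + 2 * N ≡ y + j * (+ 2 * N)
        lemma j = cong (λ w → y + w) (ℤP.*-assoc j (+ 2) N)
      lemma₀ : ∀ y M → y ≡ y + 0ℤ * M
      lemma₀ = solve-∀
      up : ∀ y j N → y + j * (+ 2 * N) + + 2 * N ≡ y + (1ℤ + j) * (+ 2 * N)
      up = solve-∀
      down : ∀ y j N → y + j * (+ 2 * N) + + 2 * - N ≡ y + (-1ℤ + j) * (+ 2 * N)
      down = solve-∀

    Level : ℤ → Set
    Level k = ∀ j → R (k * y + j * M)

    level-0 : Level 0ℤ
    level-0 j = multiple (j * + 2) (lemma j y N)
      where
      lemma : ∀ j y N → j * + 2 * N ≡ 0ℤ * y + j * (+ 2 * N)
      lemma = solve-∀

    level-1 : Level 1ℤ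
    level-1 j = subst R (lemma y j M) (first-level j)
      where
      lemma : ∀ y j M → y + j * M ≡ 1ℤ * y + j * M
      lemma = solve-∀

    level-up : ∀ k → Level k → Level (1ℤ + k) → Level (1ℤ + (1ℤ + k))
    level-up k L₀ L₁ j = subst R (result k j y M)
      (rule ((1ℤ + k) * y + (1ℤ + j) * M) M (- y) (bézout-neg (bézout-sym coprime))
        (L₁ (1ℤ + j)) (subst R (next k j y M) (L₁ (1ℤ + (1ℤ + j)))) (subst R (previous k j y M) (L₀ (1ℤ + j))))
      where
      next : ∀ k j y M → (1ℤ + k) * y + (1ℤ + (1ℤ + j)) * M ≡ (1ℤ + k) * y + (1ℤ + j) * M + M
      next = solve-∀
      previous : ∀ k j y M → k * y + (1ℤ + j) * M ≡ (1ℤ + k) * y + (1ℤ + j) * M + - y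
      previous = solve-∀
      result : ∀ k j y M → (1ℤ + k) * y + (1ℤ + j) * M - M - - y ≡ (1ℤ + (1ℤ + k)) * y + j * M
      result = solve-∀

    level-down : ∀ k → Level k → Level (1ℤ + k) → Level (-1ℤ + k)
    level-down k L₀ L₁ j = subst R (result k j y M)
      (rule (k * y + (1ℤ + j) * M) M y (bézout-sym coprime)
        (L₀ (1ℤ + j)) (subst R (next k j y M) (L₀ (1ℤ + (1ℤ + j)))) (subst R (previous k j y M) (L₁ (1ℤ + j))))
      where
      next : ∀ k j y M → k * y + (1ℤ + (1ℤ + j)) * M ≡ k * y + (1ℤ + j) * M + M
      next = solve-∀
      previous : ∀ k j y M → (1ℤ + k) * y + (1ℤ + j) * M ≡ k * y + (1ℤ + j) * M + y
      previous = solve-∀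
      result : ∀ k j y M → k * y + (1ℤ + j) * M - M - y ≡ (-1ℤ + k) * y + j * M
      result = solve-∀

    levels : ∀ k → Level k × Level (1ℤ + k)
    levels = ℤ-induction (λ k → Level k × Level (1ℤ + k)) (level-0 , level-1)
      (λ k L → proj₂ L , level-up k (proj₁ L) (proj₂ L))
      (λ k L → level-down k (proj₁ L) (proj₂ L) , subst Level (lemma k) (proj₁ L))
      where
      lemma : ∀ k → k ≡ 1ℤ + (-1ℤ + k)
      lemma = solve-∀

  all-rows : ∀ t → R t
  all-rows t = subst R (trans (lemma t s r y M) (trans (cong (t *_) e) (ℤP.*-identityʳ t)))
    (proj₁ (levels (t * s)) (t * r))
    where
    s = proj₁ coprime
    r = proj₁ (proj₂ coprime)
    e = proj₂ (proj₂ coprime)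
    lemma : ∀ t s r y M → t * s * y + t * r * M ≡ t * (s * y + r * M)
    lemma = solve-∀

-- I-stable sets strictly containing I n

-- Membership of S is not decidable, so we show that no point can be missing from S.
module Forcing (S : Subset) (stable : IStable S) where

  Forced : Point → Set
  Forced p = ¬ ¬ (p ∈ S)

  forced-vertex : ∀ d₁ d₂ u₁ u₂ v₁ v₂ → u₁ * v₂ - u₂ * v₁ ≡ 1ℤ →
    Forced (d₁ + u₁ , d₂ + u₂) → Forced (d₁ + v₁ , d₂ + v₂) → Forced (d₁ , d₂) →
    Forced (d₁ - u₁ - v₁ , d₂ - u₂ - v₂)
  forced-vertex d₁ d₂ u₁ u₂ v₁ v₂ unimodular a b d c∉S = a λ a∈S → b λ b∈S → d λ d∈S →
    stable _ _ _ _ (unimodular⇒internal d₁ d₂ u₁ u₂ v₁ v₂ unimodular) (inj₂ (inj₂ (inj₁ (a∈S , b∈S , c∉S , d∈S))))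

  forced-centre : ∀ d₁ d₂ u₁ u₂ v₁ v₂ → u₁ * v₂ - u₂ * v₁ ≡ 1ℤ →
    Forced (d₁ + u₁ , d₂ + u₂) → Forced (d₁ + v₁ , d₂ + v₂) → Forced (d₁ - u₁ - v₁ , d₂ - u₂ - v₂) →
    Forced (d₁ , d₂)
  forced-centre d₁ d₂ u₁ u₂ v₁ v₂ unimodular a b c d∉S = a λ a∈S → b λ b∈S → c λ c∈S →
    stable _ _ _ _ (unimodular⇒internal d₁ d₂ u₁ u₂ v₁ v₂ unimodular) (inj₂ (inj₂ (inj₂ (a∈S , b∈S , c∈S , d∉S))))

  Full : ℤ → Set
  Full y = ∀ x → Forced (x , y)

  full-rule : ∀ X p q → BézoutPair p q → Full X → Full (X + p) → Full (X + q) → Full (X - p - q)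
  full-rule X p q (s , t , e) full-X full-p full-q x =
    subst Forced (cong (_, X - p - q) (lemma x s t))
      (forced-vertex (x + t + - s) X t p (- s) q (trans (unimodular p q s t) e) (full-p _) (full-q _) (full-X _))
    where
    lemma : ∀ x s t → x + t + - s - t - - s ≡ x
    lemma = solve-∀
    unimodular : ∀ p q s t → t * q - p * - s ≡ s * p + t * q
    unimodular = solve-∀

  module Containing (n : ℕ) (I⊆S : I n ⊆ S) where

    forced-multiple : ∀ x k {w} → k * + n ≡ w → Forced (x , w)
    forced-multiple x k refl x∉S = x∉S (I⊆S (∣⇒∈I x (k * + n) (divides k refl)))

    all-forced : ∀ y → BézoutPair y (+ 2 * + n) → Full y → ∀ p → Forced p
    all-forced y coprime full (x , t) =
      RowPropagation.all-rows Full full-rule (+ n) (λ k x → forced-multiple x k refl) y coprime full t x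

    -- A triangle with centre in row 0 and vertices in rows y and -n moves a point of row y to row n - y.
    module Hops (y α β : ℤ) (bézout : α * + n + β * y ≡ 1ℤ) where

      hop⁺ : ∀ t z → Forced (z , y) → Forced (z + (+ 2 * α + β) + t * (+ n - + 2 * y) , + n - y)
      hop⁺ t z z∈S = subst Forced (cong₂ _,_ (landing z α β t y (+ n)) (row y (+ n)))
        (forced-vertex (z + α - t * y) 0ℤ (- α + t * y) y (- (β + t * + n)) (- + n)
          (trans (unimodular α β y t (+ n)) bézout)
          (subst Forced (cong₂ _,_ (start z α t y) (sym (ℤP.+-identityˡ y))) z∈S)
          (forced-multiple _ -1ℤ (below (+ n))) (forced-multiple _ 0ℤ (ℤP.*-zeroˡ (+ n))))
        where
        unimodular : ∀ α β y t N → (- α + t * y) * - N - y * - (β + t * N) ≡ α * N + β * y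
        unimodular = solve-∀
        start : ∀ z α t y → z ≡ z + α - t * y + (- α + t * y)
        start = solve-∀
        below : ∀ N → -1ℤ * N ≡ 0ℤ + - N
        below = solve-∀
        landing : ∀ z α β t y N →
          z + α - t * y - (- α + t * y) - - (β + t * N) ≡ z + (+ 2 * α + β) + t * (N - + 2 * y)
        landing = solve-∀
        row : ∀ y N → 0ℤ - y - - N ≡ N - y
        row = solve-∀

      hop⁻ : ∀ t z → Forced (z , y) → Forced (z - (+ 2 * α + β) + t * (+ n - + 2 * y) , + n - y)
      hop⁻ t z z∈S = subst Forced (cong₂ _,_ (landing z α β t y (+ n)) (row y (+ n)))
        (forced-vertex (z - α - t * y) 0ℤ (β - t * + n) (- + n) (α + t * y) y
          (trans (unimodular α β y t (+ n)) bézout)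
          (forced-multiple _ -1ℤ (below (+ n)))
          (subst Forced (cong₂ _,_ (start z α t y) (sym (ℤP.+-identityˡ y))) z∈S)
          (forced-multiple _ 0ℤ (ℤP.*-zeroˡ (+ n))))
        where
        unimodular : ∀ α β y t N → (β - t * N) * y - - N * (α + t * y) ≡ α * N + β * y
        unimodular = solve-∀
        start : ∀ z α t y → z ≡ z - α - t * y + (α + t * y)
        start = solve-∀
        below : ∀ N → -1ℤ * N ≡ 0ℤ + - N
        below = solve-∀
        landing : ∀ z α β t y N →
          z - α - t * y - (β - t * N) - (α + t * y) ≡ z - (+ 2 * α + β) + t * (N - + 2 * y)
        landing = solve-∀
        row : ∀ y N → 0ℤ - - N - y ≡ N - y
        row = solve-∀

    -- For odd n, returning to row y shifts by ±(n - 2y) and by ±2(2α + β), which are coprime.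
    module OddSpreading (K : ℕ) (n≡ : + n ≡ + 2 * + K + 1ℤ) (y α β : ℤ) (bézout : α * + n + β * y ≡ 1ℤ) where

      private
        N = + n
        γ = + 2 * α + β
        m = N - + 2 * y

        bézout′ : (α + β) * N + - β * (N - y) ≡ 1ℤ
        bézout′ = trans (lemma α β y N) bézout
          where
          lemma : ∀ α β y N → (α + β) * N + - β * (N - y) ≡ α * N + β * y
          lemma = solve-∀

        module Out = Hops y α β bézout
        module Back = Hops (N - y) (α + β) (- β) bézout′

        back : ∀ y N → N - (N - y) ≡ y
        back = solve-∀

        step⁺ᵐ : ∀ z → Forced (z , y) → Forced (z + m , y)
        step⁺ᵐ z p = subst Forced (cong₂ _,_ (lemma z α β y N) (back y N)) (Back.hop⁻ 0ℤ _ (Out.hop⁺ 1ℤ z p))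
          where
          lemma : ∀ z α β y N → z + (+ 2 * α + β) + 1ℤ * (N - + 2 * y) - (+ 2 * (α + β) + - β)
                    + 0ℤ * (N - + 2 * (N - y)) ≡ z + (N - + 2 * y)
          lemma = solve-∀

        step⁻ᵐ : ∀ z → Forced (z , y) → Forced (z - m , y)
        step⁻ᵐ z p = subst Forced (cong₂ _,_ (lemma z α β y N) (back y N)) (Back.hop⁻ 0ℤ _ (Out.hop⁺ -1ℤ z p))
          where
          lemma : ∀ z α β y N → z + (+ 2 * α + β) + -1ℤ * (N - + 2 * y) - (+ 2 * (α + β) + - β)
                    + 0ℤ * (N - + 2 * (N - y)) ≡ z - (N - + 2 * y)
          lemma = solve-∀

        step⁺ᵍ : ∀ z → Forced (z , y) → Forced (z + + 2 * γ , y)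
        step⁺ᵍ z p = subst Forced (cong₂ _,_ (lemma z α β y N) (back y N)) (Back.hop⁺ 0ℤ _ (Out.hop⁺ 0ℤ z p))
          where
          lemma : ∀ z α β y N → z + (+ 2 * α + β) + 0ℤ * (N - + 2 * y) + (+ 2 * (α + β) + - β)
                    + 0ℤ * (N - + 2 * (N - y)) ≡ z + + 2 * (+ 2 * α + β)
          lemma = solve-∀

        step⁻ᵍ : ∀ z → Forced (z , y) → Forced (z - + 2 * γ , y)
        step⁻ᵍ z p = subst Forced (cong₂ _,_ (lemma z α β y N) (back y N)) (Back.hop⁻ 0ℤ _ (Out.hop⁻ 0ℤ z p))
          where
          lemma : ∀ z α β y N → z - (+ 2 * α + β) + 0ℤ * (N - + 2 * y) - (+ 2 * (α + β) + - β)
                    + 0ℤ * (N - + 2 * (N - y)) ≡ z - + 2 * (+ 2 * α + β)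
          lemma = solve-∀

        -- Modulo m one has N ≡ 2y and 2(K + 1 - y) ≡ 1, so 2γ · y(K + 1 - y) ≡ γ y ≡ α N + β y = 1.
        coprime : BézoutPair (+ 2 * γ) m
        coprime = y * (+ K + 1ℤ - y) , α * (m + 1ℤ) - 1ℤ ,
          trans (cong (λ ν → y * (+ K + 1ℤ - y) * (+ 2 * γ) + (α * (ν - + 2 * y + 1ℤ) - 1ℤ) * (ν - + 2 * y)) n≡)
            (trans (lemma α β y (+ K))
              (trans (cong (λ ν → 1ℤ + (+ 2 * + K + 1ℤ - + 2 * y + 1ℤ) * (α * ν + β * y - 1ℤ)) (sym n≡))
                (trans (cong (λ w → 1ℤ + (+ 2 * + K + 1ℤ - + 2 * y + 1ℤ) * (w - 1ℤ)) bézout)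
                  (vanish (+ 2 * + K + 1ℤ - + 2 * y + 1ℤ)))))
          where
          lemma : ∀ α β y K → y * (K + 1ℤ - y) * (+ 2 * (+ 2 * α + β))
                    + (α * (+ 2 * K + 1ℤ - + 2 * y + 1ℤ) - 1ℤ) * (+ 2 * K + 1ℤ - + 2 * y)
                  ≡ 1ℤ + (+ 2 * K + 1ℤ - + 2 * y + 1ℤ) * (α * (+ 2 * K + 1ℤ) + β * y - 1ℤ)
          lemma = solve-∀
          vanish : ∀ w → 1ℤ + w * (1ℤ - 1ℤ) ≡ 1ℤ
          vanish = solve-∀

      full : ∀ z → Forced (z , y) → Full y
      full z p x = coprime-translations (λ z → Forced (z , y)) (+ 2 * γ) m coprime
        step⁺ᵍ step⁻ᵍ step⁺ᵐ step⁻ᵐ z x p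

  -- For n = 2 the rows y ± 1 around an odd row y are full of points of I 2.
  module EvenSpreading (I⊆S : I 2 ⊆ S) (s : ℤ) where
    open Containing 2 I⊆S

    private
      y = + 2 * s + 1ℤ

      step⁺ : ∀ z → Forced (z , y) → Forced (z + 1ℤ , y)
      step⁺ z p = subst Forced (cong₂ _,_ (right z) (row y))
        (forced-vertex z y 0ℤ 1ℤ -1ℤ -1ℤ refl (forced-multiple _ (s + 1ℤ) (above s)) (forced-multiple _ s (below s)) p)
        where
        above : ∀ s → (s + 1ℤ) * + 2 ≡ + 2 * s + 1ℤ + 1ℤ
        above = solve-∀
        below : ∀ s → s * + 2 ≡ + 2 * s + 1ℤ + -1ℤ
        below = solve-∀
        right : ∀ z → z - 0ℤ - -1ℤ ≡ z + 1ℤ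
        right = solve-∀
        row : ∀ y → y - 1ℤ - -1ℤ ≡ y
        row = solve-∀

      step⁻ : ∀ z → Forced (z , y) → Forced (z - 1ℤ , y)
      step⁻ z p = subst Forced (cong₂ _,_ (left z) (row y))
        (forced-vertex z y 0ℤ -1ℤ 1ℤ 1ℤ refl (forced-multiple _ s (below s)) (forced-multiple _ (s + 1ℤ) (above s)) p)
        where
        above : ∀ s → (s + 1ℤ) * + 2 ≡ + 2 * s + 1ℤ + 1ℤ
        above = solve-∀
        below : ∀ s → s * + 2 ≡ + 2 * s + 1ℤ + -1ℤ
        below = solve-∀
        left : ∀ z → z - 0ℤ - 1ℤ ≡ z - 1ℤ
        left = solve-∀
        row : ∀ y → y - -1ℤ - 1ℤ ≡ y
        row = solve-∀

    full : ∀ z → Forced (z , y) → Full y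
    full z p x = coprime-translations (λ z → Forced (z , y)) 1ℤ 1ℤ (1ℤ , 0ℤ , refl) step⁺ step⁻ step⁺ step⁻ z x p

ℤ-parity : ∀ y → ∃ λ s → (y ≡ + 2 * s) ⊎ (y ≡ + 2 * s + 1ℤ)
ℤ-parity y = y ℤ./ℕ 2 , by-remainder (ℤDM.n%ℕd<d y 2) (ℤDM.a≡a%ℕn+[a/ℕn]*n y 2)
  where
  by-remainder : ∀ {r} → r < 2 → y ≡ + r + (y ℤ./ℕ 2) * + 2 →
                 (y ≡ + 2 * (y ℤ./ℕ 2)) ⊎ (y ≡ + 2 * (y ℤ./ℕ 2) + 1ℤ)
  by-remainder {0} _ e = inj₁ (trans e (even (y ℤ./ℕ 2)))
    where
    even : ∀ s → + 0 + s * + 2 ≡ + 2 * s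
    even = solve-∀
  by-remainder {1} _ e = inj₂ (trans e (odd (y ℤ./ℕ 2)))
    where
    odd : ∀ s → + 1 + s * + 2 ≡ + 2 * s + 1ℤ
    odd = solve-∀
  by-remainder {suc (suc _)} (s≤s (s≤s ())) _

ℕ-parity : ∀ n → ∃ λ k → (n ≡ 2 ℕ.* k) ⊎ (n ≡ suc (2 ℕ.* k))
ℕ-parity zero = 0 , inj₁ refl
ℕ-parity (suc n) with ℕ-parity n
... | k , inj₁ n≡2k = k , inj₂ (cong suc n≡2k)
... | k , inj₂ n≡2k+1 = suc k , inj₁ (trans (cong suc n≡2k+1) (cong suc (sym (ℕP.+-suc k (k ℕ.+ 0)))))

pos-2k+1 : ∀ k → + suc (2 ℕ.* k) ≡ + 2 * + k + 1ℤ
pos-2k+1 k = trans (ℤP.pos-+ 1 (2 ℕ.* k)) (trans (ℤP.+-comm 1ℤ (+ (2 ℕ.* k))) (cong (_+ 1ℤ) (ℤP.pos-* 2 k)))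

module Maximality (S : Subset) (stable : IStable S) where
  open Forcing S stable

  module _ (n : ℕ) (I⊆S : I n ⊆ S) where
    open Containing n I⊆S

    Seed : Set
    Seed = ∃ λ y → ∃ λ z → BézoutPair (+ n) y × Forced (z , y)

    prime-seed : Prime n → ∀ x₀ y₀ → (x₀ , y₀) ∈ S → (x₀ , y₀) ∉ I n → Seed
    prime-seed prime-n x₀ y₀ p∈S p∉I with bézoutGcd (+ n) y₀
    ... | record { gcd = g ; s = s ; t = t ; identity = identity ; gcd∣a = g∣n ; gcd∣b = g∣y₀ }
      with prime⇒irreducible prime-n (∣⇒∣ᵤ g∣n)
    ...   | inj₁ refl = y₀ , x₀ , (s , t , identity) , λ p∉S → p∉S p∈S
    ...   | inj₂ refl = ⊥-elim (p∉I (∣⇒∈I x₀ y₀ g∣y₀))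

    -- The centre of the triangle (x₀, y₀), (x₀ + ε, 0), (x₀ + 2ε, 3ε - y₀) lies in the row ε.
    unit-row : ∀ x₀ y₀ ε k → ε * ε ≡ 1ℤ → k * + n ≡ + 3 * ε - y₀ → Forced (x₀ , y₀) → Forced (x₀ + ε , ε)
    unit-row x₀ y₀ ε k ε²≡1 k*n≡ p = forced-centre (x₀ + ε) ε (- ε) (y₀ - ε) 0ℤ (- ε)
      (trans (square ε y₀) ε²≡1)
      (subst Forced (cong₂ _,_ (first x₀ ε) (second y₀ ε)) p)
      (forced-multiple _ 0ℤ (trans (ℤP.*-zeroˡ (+ n)) (sym (ℤP.+-inverseʳ ε))))
      (forced-multiple _ k (trans k*n≡ (third y₀ ε)))
      where
      square : ∀ ε y₀ → - ε * - ε - (y₀ - ε) * 0ℤ ≡ ε * ε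
      square = solve-∀
      first : ∀ x₀ ε → x₀ ≡ x₀ + ε + - ε
      first = solve-∀
      second : ∀ y₀ ε → y₀ ≡ ε + (y₀ - ε)
      second = solve-∀
      third : ∀ y₀ ε → + 3 * ε - y₀ ≡ ε - (y₀ - ε) - - ε
      third = solve-∀

  nine-seed : (I⊆S : I 9 ⊆ S) → ∀ x₀ y₀ → (x₀ , y₀) ∈ S → (x₀ , y₀) ∉ I 9 → Seed 9 I⊆S
  nine-seed I⊆S x₀ y₀ p∈S p∉I = by-residue (ℤDM.n%ℕd<d y₀ 3) (ℤDM.a≡a%ℕn+[a/ℕn]*n y₀ 3)
    where
    open Containing 9 I⊆S
    q = y₀ ℤ./ℕ 3
    w = q ℤ./ℕ 3

    p-forced : Forced (x₀ , y₀)
    p-forced p∉S = p∉S p∈S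

    coprime-to-9 : BézoutPair (+ 3) y₀ → BézoutPair (+ 9) y₀
    coprime-to-9 b = bézout-sym (bézout-* (bézout-sym b) (bézout-sym b))

    y₀≡ : ∀ {r} → y₀ ≡ + 0 + q * + 3 → q ≡ + r + w * + 3 → y₀ ≡ + 0 + (+ r + w * + 3) * + 3
    y₀≡ e e′ = trans e (cong (λ u → + 0 + u * + 3) e′)

    by-second-residue : ∀ {r} → r < 3 → y₀ ≡ + 0 + q * + 3 → q ≡ + r + w * + 3 → Seed 9 I⊆S
    by-second-residue {0} _ e e′ = ⊥-elim (p∉I (∣⇒∈I x₀ y₀ (divides w (trans (y₀≡ e e′) (lemma w)))))
      where
      lemma : ∀ w → + 0 + (+ 0 + w * + 3) * + 3 ≡ w * + 9
      lemma = solve-∀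
    by-second-residue {1} _ e e′ = 1ℤ , x₀ + 1ℤ , (0ℤ , 1ℤ , refl) ,
      unit-row 9 I⊆S x₀ y₀ 1ℤ (- w) refl (trans (lemma w) (cong (λ v → + 3 * 1ℤ - v) (sym (y₀≡ e e′)))) p-forced
      where
      lemma : ∀ w → - w * + 9 ≡ + 3 * 1ℤ - (+ 0 + (+ 1 + w * + 3) * + 3)
      lemma = solve-∀
    by-second-residue {2} _ e e′ = -1ℤ , x₀ + -1ℤ , (0ℤ , -1ℤ , refl) ,
      unit-row 9 I⊆S x₀ y₀ -1ℤ (-1ℤ - w) refl (trans (lemma w) (cong (λ v → + 3 * -1ℤ - v) (sym (y₀≡ e e′)))) p-forced
      where
      lemma : ∀ w → (-1ℤ - w) * + 9 ≡ + 3 * -1ℤ - (+ 0 + (+ 2 + w * + 3) * + 3)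
      lemma = solve-∀
    by-second-residue {suc (suc (suc _))} (s≤s (s≤s (s≤s ()))) _ _

    by-residue : ∀ {r} → r < 3 → y₀ ≡ + r + q * + 3 → Seed 9 I⊆S
    by-residue {0} _ e = by-second-residue (ℤDM.n%ℕd<d q 3) e (ℤDM.a≡a%ℕn+[a/ℕn]*n q 3)
    by-residue {1} _ e =
      y₀ , x₀ , coprime-to-9 (- q , 1ℤ , trans (cong (λ v → - q * + 3 + 1ℤ * v) e) (lemma q)) , p-forced
      where
      lemma : ∀ q → - q * + 3 + 1ℤ * (+ 1 + q * + 3) ≡ 1ℤ
      lemma = solve-∀
    by-residue {2} _ e =
      y₀ , x₀ , coprime-to-9 (q + 1ℤ , -1ℤ , trans (cong (λ v → (q + 1ℤ) * + 3 + -1ℤ * v) e) (lemma q)) , p-forced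
      where
      lemma : ∀ q → (q + 1ℤ) * + 3 + -1ℤ * (+ 2 + q * + 3) ≡ 1ℤ
      lemma = solve-∀
    by-residue {suc (suc (suc _))} (s≤s (s≤s (s≤s ()))) _

  odd-forced : ∀ n (I⊆S : I n ⊆ S) K → n ≡ suc (2 ℕ.* K) → Seed n I⊆S → ∀ p → Forced p
  odd-forced n I⊆S K n≡2K+1 (y , z , (α , β , e) , z-forced) = from-full-row (ℤ-parity y)
    where
    open Containing n I⊆S
    N≡ : + n ≡ + 2 * + K + 1ℤ
    N≡ = trans (cong +_ n≡2K+1) (pos-2k+1 K)

    full-y : Full y
    full-y = OddSpreading.full K N≡ y α β e z z-forced

    from-full-row : (∃ λ s → (y ≡ + 2 * s) ⊎ (y ≡ + 2 * s + 1ℤ)) → ∀ p → Forced p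
    from-full-row (s , inj₂ y≡2s+1) =
      all-forced y (bézout-* (subst (λ v → BézoutPair v (+ 2)) (sym y≡2s+1) (bézout-odd s)) (bézout-sym (α , β , e)))
        full-y
    from-full-row (s , inj₁ y≡2s) = all-forced (+ n - y) (bézout-* odd (bézout-sym coprime)) full
      where
      odd : BézoutPair (+ n - y) (+ 2)
      odd = subst (λ v → BézoutPair v (+ 2))
        (trans (lemma (+ K) s) (sym (cong₂ _-_ N≡ y≡2s))) (bézout-odd (+ K - s))
        where
        lemma : ∀ K s → + 2 * (K - s) + 1ℤ ≡ + 2 * K + 1ℤ - + 2 * s
        lemma = solve-∀
      coprime : BézoutPair (+ n) (+ n - y)
      coprime = α + β , - β , trans (lemma α β y (+ n)) e
        where
        lemma : ∀ α β y N → (α + β) * N + - β * (N - y) ≡ α * N + β * y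
        lemma = solve-∀
      full : Full (+ n - y)
      full = subst Full (lemma y (+ n))
        (full-rule 0ℤ y (- + n) (bézout-neg (bézout-sym (α , β , e)))
          (λ x → forced-multiple x 0ℤ (ℤP.*-zeroˡ (+ n)))
          (subst Full (sym (ℤP.+-identityˡ y)) full-y)
          (λ x → forced-multiple x -1ℤ (trans (ℤP.-1*i≡-i (+ n)) (sym (ℤP.+-identityˡ (- + n))))))
        where
        lemma : ∀ y N → 0ℤ - y - - N ≡ N - y
        lemma = solve-∀

  two-forced : (I⊆S : I 2 ⊆ S) → ∀ x₀ y₀ → (x₀ , y₀) ∈ S → (x₀ , y₀) ∉ I 2 → ∀ p → Forced p
  two-forced I⊆S x₀ y₀ p∈S p∉I with ℤ-parity y₀
  ... | s , inj₁ y₀≡2s = ⊥-elim (p∉I (∣⇒∈I x₀ y₀ (divides s (trans y₀≡2s (ℤP.*-comm (+ 2) s)))))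
  ... | s , inj₂ y₀≡2s+1 =
    all-forced y₀ (subst (λ v → BézoutPair v (+ 2 * + 2)) (sym y₀≡2s+1) (bézout-* (bézout-odd s) (bézout-odd s)))
    (subst Full (sym y₀≡2s+1) (EvenSpreading.full I⊆S s x₀ (subst Forced (cong (x₀ ,_) y₀≡2s+1) (λ p∉S → p∉S p∈S))))
    where
    open Containing 2 I⊆S

forced-everywhere : ∀ n → n ≡ 9 ⊎ (Prime n × n ≢ 3) → ∀ S → IStable S → I n ⊆ S →
  ∀ x₀ y₀ → (x₀ , y₀) ∈ S → (x₀ , y₀) ∉ I n → ∀ p → ¬ ¬ (p ∈ S)
forced-everywhere .9 (inj₁ refl) S stable I⊆S x₀ y₀ p∈S p∉I =
  Maximality.odd-forced S stable 9 I⊆S 4 refl (Maximality.nine-seed S stable I⊆S x₀ y₀ p∈S p∉I)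
forced-everywhere n (inj₂ (prime-n , _)) S stable I⊆S x₀ y₀ p∈S p∉I with ℕ-parity n
... | K , inj₂ n≡2K+1 =
  Maximality.odd-forced S stable n I⊆S K n≡2K+1 (Maximality.prime-seed S stable n I⊆S prime-n x₀ y₀ p∈S p∉I)
... | K , inj₁ n≡2K with prime⇒irreducible prime-n (ℕD.divides K (trans n≡2K (ℕP.*-comm 2 K)))
...   | inj₂ refl = Maximality.two-forced S stable I⊆S x₀ y₀ p∈S p∉I

9-or-prime⇒maximal : ∀ n → n ≡ 9 ⊎ (Prime n × n ≢ 3) → MaximalIStable (I n)
9-or-prime⇒maximal n h = I-stable n (≢3 h) , I-proper (1<n h) ,
  λ { (S , stable , (p , p∉S) , I⊆S , (x₀ , y₀) , p∈S , p∉I) → forced-everywhere n h S stable I⊆S x₀ y₀ p∈S p∉I p p∉S }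
  where
  ≢3 : n ≡ 9 ⊎ (Prime n × n ≢ 3) → n ≢ 3
  ≢3 (inj₁ refl) ()
  ≢3 (inj₂ (_ , n≢3)) = n≢3
  1<n : n ≡ 9 ⊎ (Prime n × n ≢ 3) → 1 < n
  1<n (inj₁ refl) = s≤s (s≤s z≤n)
  1<n (inj₂ (prime-n , _)) = ℕ.nonTrivial⇒n>1 n {{prime⇒nonTrivial prime-n}}

proposition5p1 : (n : ℕ) → 1 ≤ n → (MaximalIStable (I n) ⇔ (n ≡ 9 ⊎ (Prime n × n ≢ 3)))
proposition5p1 n 1≤n = mk⇔ (maximal⇒9-or-prime n 1≤n) (9-or-prime⇒maximal n)
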